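{- Let $p$ be a prime, $A\in \mathbb{Z}^{m\times n}$, $b\in \mathbb{Z}^m$, and $P:=\{x:Ax\leq b\}$, assumed nonempty. For a nonempty face $F$ of $P$, let $A_Fx\leq b_F$ denote the subsystem of inequalities of $Ax\leq b$ that hold with equality at every point of $F$, and let $\operatorname{aff}(F)$ denote the affine hull of $F$. The following are equivalent: (1) $P$ is a $p$-adic polyhedron; (2) for every nonempty face $F$ of $P$, $\operatorname{aff}(F)$ contains a $p$-adic point; (3) for every nonempty face $F$ of $P$ and every vector $z$, if $A_F^\top z$ is integral then $b_F^\top z$ is a $p$-adic rational; (4) for every $w\in\mathbb{R}^n$ for which $\max\{w^\top x:x\in P\}$ has an optimal solution, it has a $p$-adic optimal solution; (5) for every $w\in\mathbb{Z}^n$ for which $\max\{w^\top x:x\in P\}$ has an optimal solution, its optimal value is a $p$-adic rational.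
   Context: A $p$-adic rational is a number of the form $a/p^k$ with $a,k$ integers and $k\geq 0$; a vector is $p$-adic if all its entries are. A nonempty rational polyhedron is $p$-adic if each of its nonempty faces contains a $p$-adic point.
   Formalization: Points of P and of affine hulls, the inequalities cutting out faces, the vector z in (3) and the objective w in (4) are taken over ℚ rather than ℝ. -}

module Defs where

open import Data.Nat as ℕ using (ℕ; zero; suc)
open import Data.Integer as ℤ using (ℤ; +_)
open import Data.Rational using (ℚ; _/_; 0ℚ; 1ℚ; _+_; _*_; _≤_)
open import Data.Fin using (Fin; zero; suc)
open import Data.Product using (Σ; ∃; ∃-syntax; _×_; _,_)
open import Relation.Binary.PropositionalEquality using (_≡_)
open import Relation.Nullary using (¬_)

ιℤ : ℤ → ℚ
ιℤ a = a / 1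

ιℕ : ℕ → ℚ
ιℕ k = (+ k) / 1

Σ[<] : (k : ℕ) → (Fin k → ℚ) → ℚ
Σ[<] zero    f = 0ℚ
Σ[<] (suc k) f = f zero + Σ[<] k (λ i → f (suc i))

Vecℚ : ℕ → Set
Vecℚ n = Fin n → ℚ

_·_ : {n : ℕ} → Vecℚ n → Vecℚ n → ℚ
_·_ {n} u v = Σ[<] n (λ j → u j * v j)

Matℤ : ℕ → ℕ → Set
Matℤ m n = Fin m → Fin n → ℤ

row : {m n : ℕ} → Matℤ m n → Fin m → Vecℚ n
row A i j = ιℤ (A i j)

IsPadic : ℕ → ℚ → Set
IsPadic p q = ∃[ a ] ∃[ k ] (q * ιℕ (p ℕ.^ k) ≡ ιℤ a)

IsPadicVec : {n : ℕ} → ℕ → Vecℚ n → Set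
IsPadicVec p x = ∀ j → IsPadic p (x j)

IsIntegral : ℚ → Set
IsIntegral q = ∃[ t ] (q ≡ ιℤ t)

InP : {m n : ℕ} → Matℤ m n → (Fin m → ℤ) → Vecℚ n → Set
InP A b x = ∀ i → row A i · x ≤ ιℤ (b i)

NonemptyP : {m n : ℕ} → Matℤ m n → (Fin m → ℤ) → Set
NonemptyP {n = n} A b = Σ (Vecℚ n) (InP A b)

Valid : {m n : ℕ} → Matℤ m n → (Fin m → ℤ) → Vecℚ n → ℚ → Set
Valid A b c δ = ∀ x → InP A b x → c · x ≤ δ

InFace : {m n : ℕ} → Matℤ m n → (Fin m → ℤ) → Vecℚ n → ℚ → Vecℚ n → Set
InFace A b c δ x = InP A b x × (c · x ≡ δ)

-- a nonempty face of P, given by a valid inequality whose face is nonempty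
IsNonemptyFace : {m n : ℕ} → Matℤ m n → (Fin m → ℤ) → Vecℚ n → ℚ → Set
IsNonemptyFace {n = n} A b c δ = Valid A b c δ × Σ (Vecℚ n) (InFace A b c δ)

InAffHull : {n : ℕ} → (Vecℚ n → Set) → Vecℚ n → Set
InAffHull {n} S y =
  ∃[ k ] Σ (Fin k → ℚ) λ λs → Σ (Fin k → Vecℚ n) λ xs →
    (∀ t → S (xs t)) × (Σ[<] k λs ≡ 1ℚ) × (∀ j → y j ≡ Σ[<] k (λ t → λs t * xs t j))

-- row i of A x ≤ b holds with equality at every point of the face (i.e. i belongs to A_F x ≤ b_F)
Tight : {m n : ℕ} → Matℤ m n → (Fin m → ℤ) → Vecℚ n → ℚ → Fin m → Set
Tight A b c δ i = ∀ x → InFace A b c δ x → row A i · x ≡ ιℤ (b i)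

IsOptimal : {m n : ℕ} → Matℤ m n → (Fin m → ℤ) → Vecℚ n → Vecℚ n → Set
IsOptimal A b w x = InP A b x × (∀ y → InP A b y → w · y ≤ w · x)

HasOptimal : {m n : ℕ} → Matℤ m n → (Fin m → ℤ) → Vecℚ n → Set
HasOptimal {n = n} A b w = Σ (Vecℚ n) (IsOptimal A b w)

-- (1) P is p-adic: every nonempty face contains a p-adic point
Cond1 : {m n : ℕ} → ℕ → Matℤ m n → (Fin m → ℤ) → Set
Cond1 {n = n} p A b = ∀ (c : Vecℚ n) (δ : ℚ) → IsNonemptyFace A b c δ →
  Σ (Vecℚ n) λ x → InFace A b c δ x × IsPadicVec p x

Cond2 : {m n : ℕ} → ℕ → Matℤ m n → (Fin m → ℤ) → Set
Cond2 {n = n} p A b = ∀ (c : Vecℚ n) (δ : ℚ) → IsNonemptyFace A b c δ →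
  Σ (Vecℚ n) λ y → InAffHull (InFace A b c δ) y × IsPadicVec p y

-- (3) for every nonempty face F and every z (indexed by the rows of A_F x ≤ b_F,
-- represented as z : ℚ^m vanishing outside those rows): A_F^T z integral ⇒ b_F^T z p-adic
Cond3 : {m n : ℕ} → ℕ → Matℤ m n → (Fin m → ℤ) → Set
Cond3 {m} {n} p A b = ∀ (c : Vecℚ n) (δ : ℚ) → IsNonemptyFace A b c δ →
  ∀ (z : Fin m → ℚ) → (∀ i → ¬ (z i ≡ 0ℚ) → Tight A b c δ i) →
  (∀ j → IsIntegral (Σ[<] m (λ i → ιℤ (A i j) * z i))) →
  IsPadic p (Σ[<] m (λ i → ιℤ (b i) * z i))

Cond4 : {m n : ℕ} → ℕ → Matℤ m n → (Fin m → ℤ) → Set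
Cond4 {n = n} p A b = ∀ (w : Vecℚ n) → HasOptimal A b w →
  Σ (Vecℚ n) λ x → IsOptimal A b w x × IsPadicVec p x

Cond5 : {m n : ℕ} → ℕ → Matℤ m n → (Fin m → ℤ) → Set
Cond5 {n = n} p A b = ∀ (w : Fin n → ℤ) → HasOptimal A b (λ j → ιℤ (w j)) →
  ∀ x → IsOptimal A b (λ j → ιℤ (w j)) x → IsPadic p ((λ j → ιℤ (w j)) · x)

-- Faces of P are exactly the sets of optimal solutions of linear objectives, which gives
-- (1) ⇔ (4) ⇒ (5); (1) ⇒ (2) is trivial.
-- (2) ⇒ (3): the rows of A_F x ≤ b_F are equations on aff(F), so for a p-adic y ∈ aff(F) the number
-- b_Fᵀz = (A_Fᵀz)ᵀy is p-adic.
-- (5) ⇒ (3): adding to z a large nonnegative integral vector u with the same support makes u and u + z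
-- complementary-slackness certificates for a point of F, with integral objectives Aᵀu and Aᵀ(u + z);
-- by (5) bᵀu and bᵀ(u + z) are p-adic, hence so is bᵀz.
-- (3) ⇒ (1): for x ∈ F, condition (3) for the smallest face containing x is the hypothesis of a p-adic
-- Kronecker theorem (proved by Euclid's algorithm on the columns), which yields a p-adic solution y₀ of
-- the rows tight at x. A step from x towards y₀ of small p-adic length τ, chosen so that (1 - τ) x is
-- p-adic as well, stays in P in both directions, hence in F.

module Submission where

open import Defs
open import Data.Nat.Primality using (Prime; prime⇒nonTrivial)
open import Function.Bundles using (_⇔_; mk⇔)

open import Level using (0ℓ)
open import Function.Base using (_∘_)
open import Data.Empty using (⊥; ⊥-elim)
open import Data.Product using (Σ; ∃; ∃-syntax; _×_; _,_; proj₁; proj₂)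
open import Data.Sum using (inj₁; inj₂)
open import Data.Nat as ℕ using (ℕ; zero; suc)
import Data.Nat.Properties as ℕ
import Data.Nat.DivMod as ℕ
open import Data.Nat.Coprimality using (Coprime; 1-coprimeTo; coprime-+; coprime-divisor)
  renaming (sym to coprime-sym)
open import Data.Nat.Divisibility using (_∣_; divides; ∣1⇒≡1)
open import Data.Nat.Induction using (<-wellFounded)
open import Data.Integer as ℤ using (ℤ; +_; -[1+_])
import Data.Integer.Properties as ℤ
import Data.Integer.DivMod as ℤ
open import Data.Integer.Tactic.RingSolver using () renaming (solve-∀ to solve-∀ℤ)
open import Data.Rational as ℚ using (ℚ; mkℚ; 0ℚ; 1ℚ; _+_; _*_; -_; _≤_)
import Data.Rational.Properties as ℚ
import Data.Rational.Unnormalised as ℚᵘ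
import Data.Rational.Unnormalised.Properties as ℚᵘ
open import Data.Fin using (Fin; zero; suc; _≟_)
import Data.Fin.Properties as Fin
open import Data.Vec.Functional using (_∷_)
open import Induction.WellFounded using (Acc; acc)
open import Relation.Binary.PropositionalEquality
open import Relation.Nullary using (¬_; Dec; yes; no)
open import Relation.Nullary.Decidable using (decidable-stable; dec⇒maybe)
open import Algebra.Bundles using (CommutativeRing)
import Algebra.Properties.Semiring.Sum as SemiringSum
import Algebra.Properties.CommutativeMonoid.Sum as CommutativeMonoidSum
open import Tactic.RingSolver using (solve-∀)
import Tactic.RingSolver.Core.AlmostCommutativeRing as ACR

ℚ-ring : ACR.AlmostCommutativeRing 0ℓ 0ℓ
ℚ-ring = ACR.fromCommutativeRing ℚ.+-*-commutativeRing (λ q → dec⇒maybe (0ℚ ℚ.≟ q))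

ιℤ≡mkℚ : ∀ a → ιℤ a ≡ mkℚ a 0 (coprime-sym (1-coprimeTo ℤ.∣ a ∣))
ιℤ≡mkℚ a = ℚ.↥p/↧p≡p (mkℚ a 0 (coprime-sym (1-coprimeTo ℤ.∣ a ∣)))

toℚᵘ-ιℤ : ∀ a → ℚ.toℚᵘ (ιℤ a) ℚᵘ.≃ ℚᵘ.mkℚᵘ a 0
toℚᵘ-ιℤ a = ℚᵘ.≃-reflexive (cong ℚ.toℚᵘ (ιℤ≡mkℚ a))

ιℤ-injective : ∀ {a b} → ιℤ a ≡ ιℤ b → a ≡ b
ιℤ-injective {a} {b} eq = cong ℚ.↥_ (trans (sym (ιℤ≡mkℚ a)) (trans eq (ιℤ≡mkℚ b)))

ιℤ-homo-+ : ∀ a b → ιℤ (a ℤ.+ b) ≡ ιℤ a + ιℤ b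
ιℤ-homo-+ a b = ℚ.toℚᵘ-injective (begin
  ℚ.toℚᵘ (ιℤ (a ℤ.+ b))                   ≈⟨ toℚᵘ-ιℤ (a ℤ.+ b) ⟩
  ℚᵘ.mkℚᵘ (a ℤ.+ b) 0                     ≈⟨ ℚᵘ.*≡* (cong (ℤ._* + 1) (sym a1+b1≡a+b)) ⟩
  ℚᵘ.mkℚᵘ a 0 ℚᵘ.+ ℚᵘ.mkℚᵘ b 0            ≈⟨ ℚᵘ.+-cong (toℚᵘ-ιℤ a) (toℚᵘ-ιℤ b) ⟨
  ℚ.toℚᵘ (ιℤ a) ℚᵘ.+ ℚ.toℚᵘ (ιℤ b)        ≈⟨ ℚ.toℚᵘ-homo-+ (ιℤ a) (ιℤ b) ⟨
  ℚ.toℚᵘ (ιℤ a + ιℤ b)                    ∎)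
  where
  open ℚᵘ.≃-Reasoning
  a1+b1≡a+b : a ℤ.* + 1 ℤ.+ b ℤ.* + 1 ≡ a ℤ.+ b
  a1+b1≡a+b = cong₂ ℤ._+_ (ℤ.*-identityʳ a) (ℤ.*-identityʳ b)

ιℤ-homo-* : ∀ a b → ιℤ (a ℤ.* b) ≡ ιℤ a * ιℤ b
ιℤ-homo-* a b = ℚ.toℚᵘ-injective (begin
  ℚ.toℚᵘ (ιℤ (a ℤ.* b))                   ≈⟨ toℚᵘ-ιℤ (a ℤ.* b) ⟩
  ℚᵘ.mkℚᵘ a 0 ℚᵘ.* ℚᵘ.mkℚᵘ b 0            ≈⟨ ℚᵘ.*-cong (toℚᵘ-ιℤ a) (toℚᵘ-ιℤ b) ⟨
  ℚ.toℚᵘ (ιℤ a) ℚᵘ.* ℚ.toℚᵘ (ιℤ b)        ≈⟨ ℚ.toℚᵘ-homo-* (ιℤ a) (ιℤ b) ⟨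
  ℚ.toℚᵘ (ιℤ a * ιℤ b)                    ∎)
  where open ℚᵘ.≃-Reasoning

ιℤ-homo-neg : ∀ a → ιℤ (ℤ.- a) ≡ - ιℤ a
ιℤ-homo-neg a = ℚ.toℚᵘ-injective (begin
  ℚ.toℚᵘ (ιℤ (ℤ.- a))                     ≈⟨ toℚᵘ-ιℤ (ℤ.- a) ⟩
  ℚᵘ.- ℚᵘ.mkℚᵘ a 0                        ≈⟨ ℚᵘ.-‿cong (toℚᵘ-ιℤ a) ⟨
  ℚᵘ.- ℚ.toℚᵘ (ιℤ a)                      ≈⟨ ℚ.toℚᵘ-homo‿- (ιℤ a) ⟨
  ℚ.toℚᵘ (- ιℤ a)                         ∎)
  where open ℚᵘ.≃-Reasoning

ιℤ-mono-≤ : ∀ {a b} → a ℤ.≤ b → ιℤ a ≤ ιℤ b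
ιℤ-mono-≤ {a} {b} a≤b rewrite ιℤ≡mkℚ a | ιℤ≡mkℚ b = ℚ.*≤* (ℤ.*-monoʳ-≤-nonNeg (+ 1) a≤b)

ιℕ-homo-+ : ∀ m n → ιℕ (m ℕ.+ n) ≡ ιℕ m + ιℕ n
ιℕ-homo-+ m n = ιℤ-homo-+ (+ m) (+ n)

ιℕ-homo-* : ∀ m n → ιℕ (m ℕ.* n) ≡ ιℕ m * ιℕ n
ιℕ-homo-* m n = trans (cong ιℤ (ℤ.pos-* m n)) (ιℤ-homo-* (+ m) (+ n))

ιℕ-mono-≤ : ∀ {m n} → m ℕ.≤ n → ιℕ m ≤ ιℕ n
ιℕ-mono-≤ m≤n = ιℤ-mono-≤ (ℤ.+≤+ m≤n)

ιℕ-positive : ∀ n → .{{ℕ.NonZero n}} → ℚ.Positive (ιℕ n)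
ιℕ-positive (suc n) rewrite ιℤ≡mkℚ (+ suc n) = _

module ∑ = SemiringSum (CommutativeRing.semiring ℚ.+-*-commutativeRing)

Σ≡∑ : ∀ k (f : Fin k → ℚ) → Σ[<] k f ≡ ∑.sum f
Σ≡∑ zero    f = refl
Σ≡∑ (suc k) f = cong (_+_ (f zero)) (Σ≡∑ k (f ∘ suc))

Σ-cong : ∀ k {f g : Fin k → ℚ} → (∀ i → f i ≡ g i) → Σ[<] k f ≡ Σ[<] k g
Σ-cong zero    f≗g = refl
Σ-cong (suc k) f≗g = cong₂ _+_ (f≗g zero) (Σ-cong k (f≗g ∘ suc))

Σ-zero : ∀ k → Σ[<] k (λ _ → 0ℚ) ≡ 0ℚ
Σ-zero k = trans (Σ≡∑ k _) (∑.sum-replicate-zero k)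

Σ-distrib-+ : ∀ k (f g : Fin k → ℚ) → Σ[<] k (λ i → f i + g i) ≡ Σ[<] k f + Σ[<] k g
Σ-distrib-+ k f g = trans (Σ≡∑ k _) (trans (∑.∑-distrib-+ f g) (sym (cong₂ _+_ (Σ≡∑ k f) (Σ≡∑ k g))))

Σ-comm : ∀ k l (f : Fin k → Fin l → ℚ) →
         Σ[<] k (λ i → Σ[<] l (f i)) ≡ Σ[<] l (λ j → Σ[<] k (λ i → f i j))
Σ-comm k l f = begin
  Σ[<] k (λ i → Σ[<] l (f i))              ≡⟨ Σ-cong k (λ i → Σ≡∑ l (f i)) ⟩
  Σ[<] k (λ i → ∑.sum (f i))               ≡⟨ Σ≡∑ k _ ⟩
  ∑.sum (λ i → ∑.sum (f i))                ≡⟨ ∑.∑-comm f ⟩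
  ∑.sum (λ j → ∑.sum (λ i → f i j))        ≡⟨ Σ≡∑ l _ ⟨
  Σ[<] l (λ j → ∑.sum (λ i → f i j))       ≡⟨ Σ-cong l (λ j → Σ≡∑ k (λ i → f i j)) ⟨
  Σ[<] l (λ j → Σ[<] k (λ i → f i j))      ∎
  where open ≡-Reasoning

*-distribˡ-Σ : ∀ k c (f : Fin k → ℚ) → c * Σ[<] k f ≡ Σ[<] k (λ i → c * f i)
*-distribˡ-Σ k c f = trans (cong (c *_) (Σ≡∑ k f)) (trans (∑.*-distribˡ-sum c f) (sym (Σ≡∑ k _)))

*-distribʳ-Σ : ∀ k c (f : Fin k → ℚ) → Σ[<] k f * c ≡ Σ[<] k (λ i → f i * c)
*-distribʳ-Σ k c f = trans (cong (_* c) (Σ≡∑ k f)) (trans (∑.*-distribʳ-sum c f) (sym (Σ≡∑ k _)))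

Σ-mono-≤ : ∀ k {f g : Fin k → ℚ} → (∀ i → f i ≤ g i) → Σ[<] k f ≤ Σ[<] k g
Σ-mono-≤ zero    f≤g = ℚ.≤-refl
Σ-mono-≤ (suc k) f≤g = ℚ.+-mono-≤ (f≤g zero) (Σ-mono-≤ k (f≤g ∘ suc))

Σ-≤-≡⇒≡ : ∀ k {f g : Fin k → ℚ} → (∀ i → f i ≤ g i) → Σ[<] k f ≡ Σ[<] k g → ∀ i → f i ≡ g i
Σ-≤-≡⇒≡ (suc k) {f} {g} f≤g eq zero =
  ℚ.≤-antisym (f≤g zero) (ℚ.≮⇒≥ λ lt → ℚ.<⇒≢ (ℚ.+-mono-<-≤ lt (Σ-mono-≤ k (f≤g ∘ suc))) eq)
Σ-≤-≡⇒≡ (suc k) {f} {g} f≤g eq (suc i) = Σ-≤-≡⇒≡ k (f≤g ∘ suc) tail≡ i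
  where
  tail≡ : Σ[<] k (f ∘ suc) ≡ Σ[<] k (g ∘ suc)
  tail≡ = ℚ.≤-antisym (Σ-mono-≤ k (f≤g ∘ suc)) (ℚ.≮⇒≥ λ lt → ℚ.<⇒≢ (ℚ.+-mono-≤-< (f≤g zero) lt) eq)

δ : ∀ {n} → Fin n → Fin n → ℤ
δ zero    zero    = + 1
δ zero    (suc _) = + 0
δ (suc _) zero    = + 0
δ (suc i) (suc j) = δ i j

δ-refl : ∀ {n} (j : Fin n) → δ j j ≡ + 1
δ-refl zero    = refl
δ-refl (suc j) = δ-refl j

δ-≢ : ∀ {n} {j c : Fin n} → j ≢ c → δ j c ≡ + 0
δ-≢ {j = zero}  {zero}  j≢c = ⊥-elim (j≢c refl)
δ-≢ {j = zero}  {suc c} _   = refl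
δ-≢ {j = suc j} {zero}  _   = refl
δ-≢ {j = suc j} {suc c} j≢c = δ-≢ (j≢c ∘ cong suc)

Σ-δ : ∀ n (f : Fin n → ℚ) j → Σ[<] n (λ c → ιℤ (δ j c) * f c) ≡ f j
Σ-δ (suc n) f zero    = begin
  1ℚ * f zero + Σ[<] n (λ c → 0ℚ * f (suc c))
    ≡⟨ cong₂ _+_ (ℚ.*-identityˡ (f zero)) (Σ-cong n (λ c → ℚ.*-zeroˡ (f (suc c)))) ⟩
  f zero + Σ[<] n (λ _ → 0ℚ)                    ≡⟨ cong (_+_ (f zero)) (Σ-zero n) ⟩
  f zero + 0ℚ                                   ≡⟨ ℚ.+-identityʳ (f zero) ⟩
  f zero                                        ∎
  where open ≡-Reasoning
Σ-δ (suc n) f (suc j) = trans (cong₂ _+_ (ℚ.*-zeroˡ (f zero)) (Σ-δ n (f ∘ suc) j)) (ℚ.+-identityˡ (f (suc j)))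

ιᵥ : ∀ {k} → (Fin k → ℤ) → Vecℚ k
ιᵥ b i = ιℤ (b i)

_*ᵥ_ : ∀ {k n} → Matℤ k n → Vecℚ n → Vecℚ k
(B *ᵥ y) i = row B i · y

_ᵀ*ᵥ_ : ∀ {k n} → Matℤ k n → Vecℚ k → Vecℚ n
_ᵀ*ᵥ_ {k} B z j = Σ[<] k (λ i → ιℤ (B i j) * z i)

·-congˡ : ∀ {n} {u u′ : Vecℚ n} (v : Vecℚ n) → (∀ j → u j ≡ u′ j) → u · v ≡ u′ · v
·-congˡ {n} v u≗u′ = Σ-cong n (λ j → cong (_* v j) (u≗u′ j))

·-congʳ : ∀ {n} (u : Vecℚ n) {v v′ : Vecℚ n} → (∀ j → v j ≡ v′ j) → u · v ≡ u · v′
·-congʳ {n} u v≗v′ = Σ-cong n (λ j → cong (u j *_) (v≗v′ j))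

·-linearʳ : ∀ {n} (u x d : Vecℚ n) σ → u · (λ j → x j + σ * d j) ≡ u · x + σ * (u · d)
·-linearʳ {n} u x d σ = begin
  Σ[<] n (λ j → u j * (x j + σ * d j))         ≡⟨ Σ-cong n (λ j → expand (u j) (x j) σ (d j)) ⟩
  Σ[<] n (λ j → u j * x j + σ * (u j * d j))   ≡⟨ Σ-distrib-+ n _ _ ⟩
  u · x + Σ[<] n (λ j → σ * (u j * d j))       ≡⟨ cong (_+_ (u · x)) (*-distribˡ-Σ n σ _) ⟨
  u · x + σ * (u · d)                          ∎
  where
  open ≡-Reasoning
  expand : ∀ u x σ d → u * (x + σ * d) ≡ u * x + σ * (u * d)
  expand = solve-∀ ℚ-ring

·-δʳ : ∀ {n} (u : Vecℚ n) l → u · (λ c → ιℤ (δ l c)) ≡ u l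
·-δʳ {n} u l = trans (Σ-cong n (λ c → ℚ.*-comm (u c) _)) (Σ-δ n u l)

*ᵥ-ᵀ*ᵥ-adjoint : ∀ {k n} (B : Matℤ k n) y z → (B *ᵥ y) · z ≡ (B ᵀ*ᵥ z) · y
*ᵥ-ᵀ*ᵥ-adjoint {k} {n} B y z = begin
  Σ[<] k (λ i → Σ[<] n (λ j → ιℤ (B i j) * y j) * z i)   ≡⟨ Σ-cong k (λ i → *-distribʳ-Σ n (z i) _) ⟩
  Σ[<] k (λ i → Σ[<] n (λ j → ιℤ (B i j) * y j * z i))   ≡⟨ Σ-comm k n _ ⟩
  Σ[<] n (λ j → Σ[<] k (λ i → ιℤ (B i j) * y j * z i))   ≡⟨ Σ-cong n (λ j → Σ-cong k (λ i → swap (ιℤ (B i j)) (y j) (z i))) ⟩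
  Σ[<] n (λ j → Σ[<] k (λ i → ιℤ (B i j) * z i * y j))   ≡⟨ Σ-cong n (λ j → *-distribʳ-Σ k (y j) _) ⟨
  Σ[<] n (λ j → Σ[<] k (λ i → ιℤ (B i j) * z i) * y j)   ∎
  where
  open ≡-Reasoning
  swap : ∀ a y z → a * y * z ≡ a * z * y
  swap = solve-∀ ℚ-ring

0ᵥ : ∀ {n} → Vecℚ n
0ᵥ _ = 0ℚ

·-zeroʳ : ∀ {n} (u : Vecℚ n) → u · 0ᵥ ≡ 0ℚ
·-zeroʳ {n} u = trans (Σ-cong n (λ j → ℚ.*-zeroʳ (u j))) (Σ-zero n)

·-comm : ∀ {n} (u v : Vecℚ n) → u · v ≡ v · u
·-comm {n} u v = Σ-cong n (λ j → ℚ.*-comm (u j) (v j))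

·-distribˡ-+ : ∀ {n} (u x y : Vecℚ n) → u · (λ j → x j + y j) ≡ u · x + u · y
·-distribˡ-+ {n} u x y = trans (Σ-cong n (λ j → ℚ.*-distribˡ-+ (u j) (x j) (y j))) (Σ-distrib-+ n _ _)

·-linearˡ : ∀ {n} (x d u : Vecℚ n) σ → (λ j → x j + σ * d j) · u ≡ x · u + σ * (d · u)
·-linearˡ x d u σ = begin
  (λ j → x j + σ * d j) · u     ≡⟨ ·-comm _ u ⟩
  u · (λ j → x j + σ * d j)     ≡⟨ ·-linearʳ u x d σ ⟩
  u · x + σ * (u · d)           ≡⟨ cong₂ (λ s t → s + σ * t) (·-comm u x) (·-comm u d) ⟩
  x · u + σ * (d · u)           ∎
  where open ≡-Reasoning

·-+δʳ : ∀ {n} (u y : Vecℚ n) s l → u · (λ c → y c + s * ιℤ (δ l c)) ≡ u · y + s * u l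
·-+δʳ u y s l = trans (·-linearʳ u y _ s) (cong (λ t → u · y + s * t) (·-δʳ u l))

·-+δˡ : ∀ {n} (u y : Vecℚ n) s j → (λ c → u c + s * ιℤ (δ j c)) · y ≡ u · y + s * y j
·-+δˡ u y s j = trans (·-comm _ y) (trans (·-+δʳ y u s j) (cong (_+ s * y j) (·-comm y u)))

·-cong-on-support : ∀ {m} (f g z : Vecℚ m) → (∀ i → z i ≢ 0ℚ → f i ≡ g i) → f · z ≡ g · z
·-cong-on-support {m} f g z agree = Σ-cong m termwise
  where
  termwise : ∀ i → f i * z i ≡ g i * z i
  termwise i with z i ℚ.≟ 0ℚ
  ... | yes zᵢ≡0 rewrite zᵢ≡0 = trans (ℚ.*-zeroʳ (f i)) (sym (ℚ.*-zeroʳ (g i)))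
  ... | no  zᵢ≢0 = cong (_* z i) (agree i zᵢ≢0)

integral-ιℤ : ∀ a → IsIntegral (ιℤ a)
integral-ιℤ a = a , refl

integral-+ : ∀ q r → IsIntegral q → IsIntegral r → IsIntegral (q + r)
integral-+ _ _ (a , refl) (b , refl) = a ℤ.+ b , sym (ιℤ-homo-+ a b)

integral-* : ∀ q r → IsIntegral q → IsIntegral r → IsIntegral (q * r)
integral-* _ _ (a , refl) (b , refl) = a ℤ.* b , sym (ιℤ-homo-* a b)

integral-neg : ∀ q → IsIntegral q → IsIntegral (- q)
integral-neg _ (a , refl) = ℤ.- a , sym (ιℤ-homo-neg a)

IsIntegralVec : ∀ {n} → Vecℚ n → Set
IsIntegralVec v = ∀ j → IsIntegral (v j)

integral-Σ : ∀ k (f : Fin k → ℚ) → (∀ i → IsIntegral (f i)) → IsIntegral (Σ[<] k f)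
integral-Σ zero    _ _   = integral-ιℤ (+ 0)
integral-Σ (suc k) f int = integral-+ (f zero) _ (int zero) (integral-Σ k (f ∘ suc) (int ∘ suc))

module _ (p : ℕ) where

  ιℕ-^-+ : ∀ k l → ιℕ (p ℕ.^ (k ℕ.+ l)) ≡ ιℕ (p ℕ.^ k) * ιℕ (p ℕ.^ l)
  ιℕ-^-+ k l = trans (cong ιℕ (ℕ.^-distribˡ-+-* p k l)) (ιℕ-homo-* (p ℕ.^ k) (p ℕ.^ l))

  integral⇒padic : ∀ q → IsIntegral q → IsPadic p q
  integral⇒padic _ (a , refl) = a , 0 , ℚ.*-identityʳ (ιℤ a)

  padic-ιℤ : ∀ a → IsPadic p (ιℤ a)
  padic-ιℤ a = integral⇒padic (ιℤ a) (integral-ιℤ a)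

  padic-+ : ∀ q r → IsPadic p q → IsPadic p r → IsPadic p (q + r)
  padic-+ q r (a , k , qP≡a) (b , l , rP≡b) = a ℤ.* + (p ℕ.^ l) ℤ.+ b ℤ.* + (p ℕ.^ k) , k ℕ.+ l , (begin
    (q + r) * ιℕ (p ℕ.^ (k ℕ.+ l))                        ≡⟨ cong ((q + r) *_) (ιℕ-^-+ k l) ⟩
    (q + r) * (Pk * Pl)                                   ≡⟨ expand q r Pk Pl ⟩
    q * Pk * Pl + r * Pl * Pk                             ≡⟨ cong₂ (λ s t → s * Pl + t * Pk) qP≡a rP≡b ⟩
    ιℤ a * Pl + ιℤ b * Pk                                 ≡⟨ cong₂ _+_ (ιℤ-homo-* a _) (ιℤ-homo-* b _) ⟨
    ιℤ (a ℤ.* + (p ℕ.^ l)) + ιℤ (b ℤ.* + (p ℕ.^ k))       ≡⟨ ιℤ-homo-+ (a ℤ.* + (p ℕ.^ l)) (b ℤ.* + (p ℕ.^ k)) ⟨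
    ιℤ (a ℤ.* + (p ℕ.^ l) ℤ.+ b ℤ.* + (p ℕ.^ k))          ∎)
    where
    open ≡-Reasoning
    Pk = ιℕ (p ℕ.^ k)
    Pl = ιℕ (p ℕ.^ l)
    expand : ∀ q r s t → (q + r) * (s * t) ≡ q * s * t + r * t * s
    expand = solve-∀ ℚ-ring

  padic-* : ∀ q r → IsPadic p q → IsPadic p r → IsPadic p (q * r)
  padic-* q r (a , k , qP≡a) (b , l , rP≡b) = a ℤ.* b , k ℕ.+ l , (begin
    q * r * ιℕ (p ℕ.^ (k ℕ.+ l))                          ≡⟨ cong (q * r *_) (ιℕ-^-+ k l) ⟩
    q * r * (ιℕ (p ℕ.^ k) * ιℕ (p ℕ.^ l))                 ≡⟨ regroup q r _ _ ⟩
    q * ιℕ (p ℕ.^ k) * (r * ιℕ (p ℕ.^ l))                 ≡⟨ cong₂ _*_ qP≡a rP≡b ⟩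
    ιℤ a * ιℤ b                                           ≡⟨ ιℤ-homo-* a b ⟨
    ιℤ (a ℤ.* b)                                          ∎)
    where
    open ≡-Reasoning
    regroup : ∀ q r s t → q * r * (s * t) ≡ q * s * (r * t)
    regroup = solve-∀ ℚ-ring

  padic-neg : ∀ q → IsPadic p q → IsPadic p (- q)
  padic-neg q (a , k , qP≡a) = ℤ.- a , k ,
    trans (sym (ℚ.neg-distribˡ-* q _)) (trans (cong -_ qP≡a) (sym (ιℤ-homo-neg a)))

  padic-difference : ∀ q r → IsPadic p (q + r) → IsPadic p q → IsPadic p r
  padic-difference q r padic-q+r padic-q =
    subst (IsPadic p) (cancel q r) (padic-+ (q + r) (- q) padic-q+r (padic-neg q padic-q))
    where
    cancel : ∀ q r → q + r + - q ≡ r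
    cancel = solve-∀ ℚ-ring

  padic-Σ : ∀ k (f : Fin k → ℚ) → (∀ i → IsPadic p (f i)) → IsPadic p (Σ[<] k f)
  padic-Σ zero    _ _     = integral⇒padic 0ℚ (integral-ιℤ (+ 0))
  padic-Σ (suc k) f padic = padic-+ (f zero) _ (padic zero) (padic-Σ k (f ∘ suc) (padic ∘ suc))

  padic-· : ∀ {n} (u v : Vecℚ n) → IsPadicVec p u → IsPadicVec p v → IsPadic p (u · v)
  padic-· {n} u v pu pv = padic-Σ n _ (λ j → padic-* (u j) (v j) (pu j) (pv j))

  1+p∤p^ : .{{ℕ.NonZero p}} → ∀ k → ¬ (suc p ∣ p ℕ.^ k)
  1+p∤p^ zero    1+p∣1     = ℕ.≢-nonZero⁻¹ p (ℕ.suc-injective (∣1⇒≡1 1+p∣1))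
  1+p∤p^ (suc k) 1+p∣p^1+k = 1+p∤p^ k (coprime-divisor 1+p⊥p 1+p∣p^1+k)
    where
    1+p⊥p : Coprime (suc p) p
    1+p⊥p = subst (λ m → Coprime m p) (ℕ.+-comm p 1) (coprime-+ (1-coprimeTo p))

  inverse-of-1+p-not-padic : .{{ℕ.NonZero p}} → ∀ t → ιℕ (suc p) * t ≡ 1ℚ → ¬ IsPadic p t
  inverse-of-1+p-not-padic t [1+p]t≡1 (a , k , tP≡a) = 1+p∤p^ k (divides ℤ.∣ a ∣ p^k≡∣a∣[1+p])
    where
    open ≡-Reasoning
    ιp^k≡ : ιℕ (p ℕ.^ k) ≡ ιℤ (+ suc p ℤ.* a)
    ιp^k≡ = begin
      ιℕ (p ℕ.^ k)                      ≡⟨ ℚ.*-identityˡ _ ⟨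
      1ℚ * ιℕ (p ℕ.^ k)                 ≡⟨ cong (_* ιℕ (p ℕ.^ k)) [1+p]t≡1 ⟨
      ιℕ (suc p) * t * ιℕ (p ℕ.^ k)     ≡⟨ ℚ.*-assoc (ιℕ (suc p)) t _ ⟩
      ιℕ (suc p) * (t * ιℕ (p ℕ.^ k))   ≡⟨ cong (ιℕ (suc p) *_) tP≡a ⟩
      ιℕ (suc p) * ιℤ a                 ≡⟨ ιℤ-homo-* (+ suc p) a ⟨
      ιℤ (+ suc p ℤ.* a)                ∎
    p^k≡∣a∣[1+p] : p ℕ.^ k ≡ ℤ.∣ a ∣ ℕ.* suc p
    p^k≡∣a∣[1+p] = begin
      p ℕ.^ k                           ≡⟨ cong ℤ.∣_∣ (ιℤ-injective {+ (p ℕ.^ k)} {+ suc p ℤ.* a} ιp^k≡) ⟩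
      ℤ.∣ + suc p ℤ.* a ∣               ≡⟨ ℤ.∣i*j∣≡∣i∣*∣j∣ (+ suc p) a ⟩
      suc p ℕ.* ℤ.∣ a ∣                 ≡⟨ ℕ.*-comm (suc p) _ ⟩
      ℤ.∣ a ∣ ℕ.* suc p                 ∎

  padic-multiples⇒zero : .{{ℕ.NonZero p}} → ∀ q → (∀ t → IsPadic p (q * t)) → q ≡ 0ℚ
  padic-multiples⇒zero q all-padic = decidable-stable (q ℚ.≟ 0ℚ) (λ q≢0 → padic-inverse q≢0)
    where
    padic-inverse : q ≢ 0ℚ → ⊥
    padic-inverse q≢0 = inverse-of-1+p-not-padic (q * (1/q * ε)) [1+p]qt≡1 (all-padic (1/q * ε))
      where
      instance
        _ = ℚ.≢-nonZero q≢0
        _ = ℚ.pos⇒nonZero (ιℕ (suc p)) {{ιℕ-positive (suc p)}}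
      1/q = ℚ.1/ q
      ε = ℚ.1/ ιℕ (suc p)
      [1+p]qt≡1 : ιℕ (suc p) * (q * (1/q * ε)) ≡ 1ℚ
      [1+p]qt≡1 = begin
        ιℕ (suc p) * (q * (1/q * ε))   ≡⟨ cong (ιℕ (suc p) *_) (ℚ.*-assoc q 1/q ε) ⟨
        ιℕ (suc p) * (q * 1/q * ε)     ≡⟨ cong (λ s → ιℕ (suc p) * (s * ε)) (ℚ.*-inverseʳ q) ⟩
        ιℕ (suc p) * (1ℚ * ε)          ≡⟨ cong (ιℕ (suc p) *_) (ℚ.*-identityˡ ε) ⟩
        ιℕ (suc p) * ε                 ≡⟨ ℚ.*-inverseʳ (ιℕ (suc p)) ⟩
        1ℚ                             ∎
        where open ≡-Reasoning

archimedean : ∀ q → ∃[ N ] q ≤ ιℕ N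
archimedean (mkℚ -[1+ n ] d _) = 0 , ℚ.<⇒≤ (ℚ.negative⁻¹ _)
archimedean q@(mkℚ (+ n) d _) = n , q≤n
  where
  q≤n : q ≤ ιℕ n
  q≤n rewrite ιℤ≡mkℚ (+ n) = ℚ.*≤* (ℤ.*-monoˡ-≤-nonNeg (+ n) (ℤ.+≤+ (ℕ.s≤s ℕ.z≤n)))

q≤∣q∣ : ∀ q → q ≤ ℚ.∣ q ∣
q≤∣q∣ q with ℚ.≤-total 0ℚ q
... | inj₁ 0≤q = ℚ.≤-reflexive (sym (ℚ.0≤p⇒∣p∣≡p 0≤q))
... | inj₂ q≤0 = ℚ.≤-trans q≤0 (ℚ.0≤∣p∣ q)

scaled-bound : ∀ a s → 0ℚ ≤ s → (s ≡ 0ℚ → a ≡ 0ℚ) → ∃ λ N → ℚ.∣ a ∣ ≤ ιℕ N * s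
scaled-bound a s 0≤s s≡0⇒a≡0 with s ℚ.≟ 0ℚ
... | yes s≡0 = 0 , ℚ.≤-reflexive (trans (cong ℚ.∣_∣ (s≡0⇒a≡0 s≡0)) (sym (ℚ.*-zeroˡ s)))
... | no  s≢0 = N , (begin
  ℚ.∣ a ∣                          ≡⟨ cancel ⟨
  ℚ.∣ a ∣ * ℚ.1/ s * s             ≤⟨ ℚ.*-monoʳ-≤-nonNeg s {{ℚ.nonNegative 0≤s}} (proj₂ (archimedean (ℚ.∣ a ∣ * ℚ.1/ s))) ⟩
  ιℕ N * s                         ∎)
  where
  open ℚ.≤-Reasoning
  instance _ = ℚ.≢-nonZero s≢0
  N = proj₁ (archimedean (ℚ.∣ a ∣ * ℚ.1/ s))
  cancel : ℚ.∣ a ∣ * ℚ.1/ s * s ≡ ℚ.∣ a ∣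
  cancel = trans (ℚ.*-assoc ℚ.∣ a ∣ (ℚ.1/ s) s) (trans (cong (ℚ.∣ a ∣ *_) (ℚ.*-inverseˡ s)) (ℚ.*-identityʳ ℚ.∣ a ∣))

scaled-step : ∀ σ a s N → 0ℚ ≤ s → ℚ.∣ a ∣ ≤ ιℕ N * s → ιℕ N * ℚ.∣ σ ∣ ≤ 1ℚ → σ * a ≤ s
scaled-step σ a s N 0≤s ∣a∣≤Ns N∣σ∣≤1 = begin
  σ * a                        ≤⟨ q≤∣q∣ (σ * a) ⟩
  ℚ.∣ σ * a ∣                  ≡⟨ ℚ.∣p*q∣≡∣p∣*∣q∣ σ a ⟩
  ℚ.∣ σ ∣ * ℚ.∣ a ∣            ≤⟨ ℚ.*-monoˡ-≤-nonNeg ℚ.∣ σ ∣ {{ℚ.∣-∣-nonNeg σ}} ∣a∣≤Ns ⟩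
  ℚ.∣ σ ∣ * (ιℕ N * s)         ≡⟨ reorder ℚ.∣ σ ∣ (ιℕ N) s ⟩
  ιℕ N * ℚ.∣ σ ∣ * s           ≤⟨ ℚ.*-monoʳ-≤-nonNeg s {{ℚ.nonNegative 0≤s}} N∣σ∣≤1 ⟩
  1ℚ * s                       ≡⟨ ℚ.*-identityˡ s ⟩
  s                            ∎
  where
  open ℚ.≤-Reasoning
  reorder : ∀ s n t → s * (n * t) ≡ n * s * t
  reorder = solve-∀ ℚ-ring

common-bound : ∀ m (P : Fin m → ℕ → Set) → (∀ i {M N} → M ℕ.≤ N → P i M → P i N) →
               (∀ i → ∃ (P i)) → ∃ λ N → ∀ i → P i N
common-bound zero    P mono bound = 0 , λ ()
common-bound (suc m) P mono bound with bound zero | common-bound m (P ∘ suc) (mono ∘ suc) (bound ∘ suc)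
... | N₀ , P₀N₀ | N , PN = N₀ ℕ.⊔ N , λ where
  zero    → mono zero (ℕ.m≤m⊔n N₀ N) P₀N₀
  (suc i) → mono (suc i) (ℕ.m≤n⊔m N₀ N) (PN i)

denominator-clears : ∀ q → IsIntegral (ιℕ (ℚ.↧ₙ q) * q)
denominator-clears q@(mkℚ n d _) = n , ℚ.toℚᵘ-injective (begin
  ℚ.toℚᵘ (ιℕ (suc d) * q)                 ≈⟨ ℚ.toℚᵘ-homo-* (ιℕ (suc d)) q ⟩
  ℚ.toℚᵘ (ιℕ (suc d)) ℚᵘ.* ℚᵘ.mkℚᵘ n d    ≈⟨ ℚᵘ.*-congʳ (toℚᵘ-ιℤ (+ suc d)) ⟩
  ℚᵘ.mkℚᵘ (+ suc d) 0 ℚᵘ.* ℚᵘ.mkℚᵘ n d    ≈⟨ ℚᵘ.*≡* cross ⟩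
  ℚᵘ.mkℚᵘ n 0                             ≈⟨ toℚᵘ-ιℤ n ⟨
  ℚ.toℚᵘ (ιℤ n)                           ∎)
  where
  open ℚᵘ.≃-Reasoning
  cross : + suc d ℤ.* n ℤ.* + 1 ≡ n ℤ.* + suc (d ℕ.+ 0)
  cross = trans (ℤ.*-identityʳ _) (trans (ℤ.*-comm (+ suc d) n) (cong (λ e → n ℤ.* + suc e) (sym (ℕ.+-identityʳ d))))

common-denominator : ∀ {n} (x : Vecℚ n) → Σ ℕ λ D → ℕ.NonZero D × IsIntegralVec (λ j → ιℕ D * x j)
common-denominator {zero}  x = 1 , _ , λ ()
common-denominator {suc n} x with common-denominator (x ∘ suc)
... | D , D≢0 , Dx-integral = d₀ ℕ.* D , ℕ.m*n≢0 d₀ D {{_}} {{D≢0}} , integral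
  where
  d₀ = ℚ.↧ₙ (x zero)
  reassociate : ∀ a b c → ιℕ (a ℕ.* b) * c ≡ ιℕ a * (ιℕ b * c)
  reassociate a b c = trans (cong (_* c) (ιℕ-homo-* a b)) (ℚ.*-assoc (ιℕ a) (ιℕ b) c)
  integral : IsIntegralVec (λ j → ιℕ (d₀ ℕ.* D) * x j)
  integral zero = subst IsIntegral (sym (trans (reassociate d₀ D (x zero)) (reorder (ιℕ d₀) (ιℕ D) (x zero))))
    (integral-* _ _ (integral-ιℤ (+ D)) (denominator-clears (x zero)))
    where
    reorder : ∀ a b c → a * (b * c) ≡ b * (a * c)
    reorder = solve-∀ ℚ-ring
  integral (suc j) = subst IsIntegral (sym (reassociate d₀ D (x (suc j))))
    (integral-* _ _ (integral-ιℤ (+ d₀)) (Dx-integral j))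

n<p^n : ∀ {p} → 1 ℕ.< p → ∀ n → n ℕ.< p ℕ.^ n
n<p^n 1<p zero    = ℕ.s≤s ℕ.z≤n
n<p^n {p} 1<p (suc n) = ℕ.≤-<-trans (n<p^n 1<p n) (ℕ.^-monoʳ-< p 1<p (ℕ.n<1+n n))

-- τ = r / p^K with r = p^K mod D, so that 1 - τ = (p^K div D) · D / p^K clears the denominators of x.
padic-shrink : ∀ p → 1 ℕ.< p → ∀ {n} (x : Vecℚ n) N → Σ ℚ λ τ →
  0ℚ ≤ τ × ιℕ N * τ ≤ 1ℚ × IsPadic p τ × IsPadicVec p (λ j → (1ℚ + - τ) * x j)
padic-shrink p 1<p x N = τ , 0≤τ , Nτ≤1 , (+ r , K , τP≡r) , padic-x
  where
  D,Dx = common-denominator x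
  D = proj₁ D,Dx
  Dx-integral = proj₂ (proj₂ D,Dx)
  instance
    D≢0 = proj₁ (proj₂ D,Dx)
    p≢0 = ℕ.>-nonZero (ℕ.<⇒≤ 1<p)
  K = N ℕ.* D
  P = p ℕ.^ K
  instance
    P≢0 = ℕ.m^n≢0 p K
    ιP>0 = ιℕ-positive P
    ιP≢0 = ℚ.pos⇒nonZero (ιℕ P)
  r = P ℕ.% D
  a = P ℕ./ D
  τ = ιℕ r * ℚ.1/ ιℕ P
  τP≡r : τ * ιℕ P ≡ ιℕ r
  τP≡r = trans (ℚ.*-assoc (ιℕ r) _ (ιℕ P)) (trans (cong (ιℕ r *_) (ℚ.*-inverseˡ (ιℕ P))) (ℚ.*-identityʳ (ιℕ r)))
  0≤τ : 0ℚ ≤ τ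
  0≤τ = ℚ.*-cancelʳ-≤-pos (ιℕ P) (subst₂ _≤_ (sym (ℚ.*-zeroˡ (ιℕ P))) (sym τP≡r) (ιℕ-mono-≤ {0} {r} ℕ.z≤n))
  Nr≤P : N ℕ.* r ℕ.≤ P
  Nr≤P = ℕ.≤-trans (ℕ.*-monoʳ-≤ N (ℕ.<⇒≤ (ℕ.m%n<n P D))) (ℕ.<⇒≤ (n<p^n 1<p K))
  Nτ≤1 : ιℕ N * τ ≤ 1ℚ
  Nτ≤1 = ℚ.*-cancelʳ-≤-pos (ιℕ P) (begin
    ιℕ N * τ * ιℕ P       ≡⟨ trans (ℚ.*-assoc (ιℕ N) τ (ιℕ P)) (cong (ιℕ N *_) τP≡r) ⟩
    ιℕ N * ιℕ r           ≡⟨ ιℕ-homo-* N r ⟨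
    ιℕ (N ℕ.* r)          ≤⟨ ιℕ-mono-≤ Nr≤P ⟩
    ιℕ P                  ≡⟨ ℚ.*-identityˡ (ιℕ P) ⟨
    1ℚ * ιℕ P             ∎)
    where open ℚ.≤-Reasoning
  [1-τ]P≡aD : (1ℚ + - τ) * ιℕ P ≡ ιℕ a * ιℕ D
  [1-τ]P≡aD = begin
    (1ℚ + - τ) * ιℕ P             ≡⟨ expand τ (ιℕ P) ⟩
    ιℕ P + - (τ * ιℕ P)           ≡⟨ cong₂ (λ s t → s + - t) (cong ιℕ (ℕ.m≡m%n+[m/n]*n P D)) τP≡r ⟩
    ιℕ (r ℕ.+ a ℕ.* D) + - ιℕ r    ≡⟨ cong (_+ - ιℕ r) (trans (ιℕ-homo-+ r (a ℕ.* D)) (cong (_+_ (ιℕ r)) (ιℕ-homo-* a D))) ⟩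
    ιℕ r + ιℕ a * ιℕ D + - ιℕ r    ≡⟨ cancel (ιℕ r) (ιℕ a * ιℕ D) ⟩
    ιℕ a * ιℕ D                   ∎
    where
    open ≡-Reasoning
    expand : ∀ t P → (1ℚ + - t) * P ≡ P + - (t * P)
    expand = solve-∀ ℚ-ring
    cancel : ∀ r s → r + s + - r ≡ s
    cancel = solve-∀ ℚ-ring
  padic-x : IsPadicVec p (λ j → (1ℚ + - τ) * x j)
  padic-x j = + a ℤ.* Dxⱼ , K , (begin
    (1ℚ + - τ) * x j * ιℕ P         ≡⟨ reorder (1ℚ + - τ) (x j) (ιℕ P) ⟩
    (1ℚ + - τ) * ιℕ P * x j         ≡⟨ cong (_* x j) [1-τ]P≡aD ⟩
    ιℕ a * ιℕ D * x j               ≡⟨ ℚ.*-assoc (ιℕ a) (ιℕ D) (x j) ⟩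
    ιℕ a * (ιℕ D * x j)             ≡⟨ cong (ιℕ a *_) (proj₂ (Dx-integral j)) ⟩
    ιℕ a * ιℤ Dxⱼ                   ≡⟨ ιℤ-homo-* (+ a) Dxⱼ ⟨
    ιℤ (+ a ℤ.* Dxⱼ)                ∎)
    where
    open ≡-Reasoning
    Dxⱼ = proj₁ (Dx-integral j)
    reorder : ∀ s x P → s * x * P ≡ s * P * x
    reorder = solve-∀ ℚ-ring

nonnegative-shift : ∀ {m} (z : Vecℚ m) → Σ (Fin m → ℤ) λ u →
  (∀ i → 0ℚ ≤ ιℤ (u i)) × (∀ i → 0ℚ ≤ ιℤ (u i) + z i) × (∀ i → z i ≡ 0ℚ → u i ≡ + 0)
nonnegative-shift {m} z = u , u≥0 , u+z≥0 , u-support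
  where
  N,bound = common-bound m (λ i N → - z i ≤ ιℕ N) (λ i M≤N -zᵢ≤M → ℚ.≤-trans -zᵢ≤M (ιℕ-mono-≤ M≤N))
                       (λ i → archimedean (- z i))
  N = proj₁ N,bound
  u : Fin m → ℤ
  u i with z i ℚ.≟ 0ℚ
  ... | yes _ = + 0
  ... | no  _ = + N
  u≥0 : ∀ i → 0ℚ ≤ ιℤ (u i)
  u≥0 i with z i ℚ.≟ 0ℚ
  ... | yes _ = ℚ.≤-refl
  ... | no  _ = ιℕ-mono-≤ {0} {N} ℕ.z≤n
  u+z≥0 : ∀ i → 0ℚ ≤ ιℤ (u i) + z i
  u+z≥0 i with z i ℚ.≟ 0ℚ
  ... | yes zᵢ≡0 = ℚ.≤-reflexive (sym (trans (ℚ.+-identityˡ (z i)) zᵢ≡0))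
  ... | no  _    = subst (_≤ ιℕ N + z i) (ℚ.+-inverseˡ (z i)) (ℚ.+-monoˡ-≤ (z i) (proj₂ N,bound i))
  u-support : ∀ i → z i ≡ 0ℚ → u i ≡ + 0
  u-support i zᵢ≡0 with z i ℚ.≟ 0ℚ
  ... | yes _    = refl
  ... | no  zᵢ≢0 = ⊥-elim (zᵢ≢0 zᵢ≡0)

addColumn : ∀ {k n} → Matℤ k n → Fin n → Fin n → ℤ → Matℤ k n
addColumn B j l σ i c = B i c ℤ.+ σ ℤ.* B i l ℤ.* δ j c

module _ {k n} (B : Matℤ k n) (j l : Fin n) (σ : ℤ) where

  addColumn-≢ : ∀ {c} → j ≢ c → ∀ i → addColumn B j l σ i c ≡ B i c
  addColumn-≢ j≢c i rewrite δ-≢ j≢c | ℤ.*-zeroʳ (σ ℤ.* B i l) = ℤ.+-identityʳ _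

  addColumn-≡ : ∀ i → addColumn B j l σ i j ≡ B i j ℤ.+ σ ℤ.* B i l
  addColumn-≡ i rewrite δ-refl j = cong (ℤ._+_ (B i j)) (ℤ.*-identityʳ _)

  ιℤ-addColumn : ∀ i c → ιℤ (addColumn B j l σ i c) ≡ ιℤ (B i c) + ιℤ σ * ιℤ (B i l) * ιℤ (δ j c)
  ιℤ-addColumn i c = trans (ιℤ-homo-+ (B i c) (σ ℤ.* B i l ℤ.* δ j c))
    (cong (_+_ (ιℤ (B i c))) (trans (ιℤ-homo-* (σ ℤ.* B i l) (δ j c)) (cong (_* ιℤ (δ j c)) (ιℤ-homo-* σ (B i l)))))

  *ᵥ-addColumn : ∀ y i → (addColumn B j l σ *ᵥ y) i ≡ (B *ᵥ y) i + ιℤ σ * ιℤ (B i l) * y j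
  *ᵥ-addColumn y i = trans (·-congˡ y (ιℤ-addColumn i)) (·-+δˡ (row B i) y (ιℤ σ * ιℤ (B i l)) j)

  ᵀ*ᵥ-addColumn : ∀ z c → (addColumn B j l σ ᵀ*ᵥ z) c ≡ (B ᵀ*ᵥ z) c + ιℤ σ * (B ᵀ*ᵥ z) l * ιℤ (δ j c)
  ᵀ*ᵥ-addColumn z c = begin
    Σ[<] k (λ i → ιℤ (addColumn B j l σ i c) * z i)
      ≡⟨ Σ-cong k termwise ⟩
    Σ[<] k (λ i → ιℤ (B i c) * z i + ιℤ σ * ιℤ (δ j c) * (ιℤ (B i l) * z i))
      ≡⟨ Σ-distrib-+ k _ _ ⟩
    (B ᵀ*ᵥ z) c + Σ[<] k (λ i → ιℤ σ * ιℤ (δ j c) * (ιℤ (B i l) * z i))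
      ≡⟨ cong (_+_ ((B ᵀ*ᵥ z) c)) (*-distribˡ-Σ k (ιℤ σ * ιℤ (δ j c)) (λ i → ιℤ (B i l) * z i)) ⟨
    (B ᵀ*ᵥ z) c + ιℤ σ * ιℤ (δ j c) * (B ᵀ*ᵥ z) l
      ≡⟨ cong (_+_ ((B ᵀ*ᵥ z) c)) (reorder (ιℤ σ) (ιℤ (δ j c)) ((B ᵀ*ᵥ z) l)) ⟩
    (B ᵀ*ᵥ z) c + ιℤ σ * (B ᵀ*ᵥ z) l * ιℤ (δ j c)
      ∎
    where
    open ≡-Reasoning
    expand : ∀ b s bl d z → (b + s * bl * d) * z ≡ b * z + s * d * (bl * z)
    expand = solve-∀ ℚ-ring
    termwise : ∀ i → ιℤ (addColumn B j l σ i c) * z i ≡ ιℤ (B i c) * z i + ιℤ σ * ιℤ (δ j c) * (ιℤ (B i l) * z i)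
    termwise i = trans (cong (_* z i) (ιℤ-addColumn i c)) (expand (ιℤ (B i c)) (ιℤ σ) (ιℤ (B i l)) (ιℤ (δ j c)) (z i))
    reorder : ∀ s d t → s * d * t ≡ s * t * d
    reorder = solve-∀ ℚ-ring

data RowShape {n} (r : Fin n → ℤ) : Set where
  zeroRow        : (∀ c → r c ≡ + 0) → RowShape r
  multipleOfUnit : ∀ l g → g ≢ + 0 → (∀ c → r c ≡ g ℤ.* δ l c) → RowShape r
  twoNonzero     : ∀ j l → j ≢ l → r j ≢ + 0 → r l ≢ + 0 → RowShape r

rowShape : ∀ {n} (r : Fin n → ℤ) → RowShape r
rowShape {zero}  r = zeroRow (λ ())
rowShape {suc n} r with rowShape (r ∘ suc) | r zero ℤ.≟ + 0
... | zeroRow r′≡0 | yes r₀≡0 = zeroRow λ where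
  zero    → r₀≡0
  (suc c) → r′≡0 c
... | zeroRow r′≡0 | no r₀≢0 = multipleOfUnit zero (r zero) r₀≢0 λ where
  zero    → sym (ℤ.*-identityʳ (r zero))
  (suc c) → trans (r′≡0 c) (sym (ℤ.*-zeroʳ (r zero)))
... | multipleOfUnit l g g≢0 r′≡gδ | yes r₀≡0 = multipleOfUnit (suc l) g g≢0 λ where
  zero    → trans r₀≡0 (sym (ℤ.*-zeroʳ g))
  (suc c) → r′≡gδ c
... | multipleOfUnit l g g≢0 r′≡gδ | no r₀≢0 = twoNonzero zero (suc l) (λ ()) r₀≢0 r₁₊ₗ≢0
  where
  r₁₊ₗ≢0 : r (suc l) ≢ + 0
  r₁₊ₗ≢0 eq = g≢0 (trans (sym (ℤ.*-identityʳ g)) (trans (cong (g ℤ.*_) (sym (δ-refl l))) (trans (sym (r′≡gδ l)) eq)))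
... | twoNonzero j l j≢l rⱼ≢0 rₗ≢0 | _ = twoNonzero (suc j) (suc l) (j≢l ∘ Fin.suc-injective) rⱼ≢0 rₗ≢0

module ∑ℕ = CommutativeMonoidSum ℕ.+-0-commutativeMonoid

∑ℕ-mono-≤ : ∀ n {f g : Fin n → ℕ} → (∀ c → f c ℕ.≤ g c) → ∑ℕ.sum f ℕ.≤ ∑ℕ.sum g
∑ℕ-mono-≤ zero    f≤g = ℕ.z≤n
∑ℕ-mono-≤ (suc n) f≤g = ℕ.+-mono-≤ (f≤g zero) (∑ℕ-mono-≤ n (f≤g ∘ suc))

∑ℕ-mono-< : ∀ n {f g : Fin n → ℕ} → (∀ c → f c ℕ.≤ g c) → ∀ j → f j ℕ.< g j → ∑ℕ.sum f ℕ.< ∑ℕ.sum g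
∑ℕ-mono-< (suc n) f≤g zero    f₀<g₀ = ℕ.+-mono-<-≤ f₀<g₀ (∑ℕ-mono-≤ n (f≤g ∘ suc))
∑ℕ-mono-< (suc n) f≤g (suc j) fⱼ<gⱼ = ℕ.+-mono-≤-< (f≤g zero) (∑ℕ-mono-< n (f≤g ∘ suc) j fⱼ<gⱼ)

firstRowSize : ∀ {k n} → Matℤ (suc k) n → ℕ
firstRowSize B = ∑ℕ.sum (λ c → ℤ.∣ B zero c ∣)

-- Adding this multiple of column l to column j replaces B₀ⱼ by its remainder modulo B₀ₗ.
euclidMultiplier : ∀ {k n} (B : Matℤ (suc k) n) (j l : Fin n) → B zero l ≢ + 0 → ℤ
euclidMultiplier B j l B₀ₗ≢0 = ℤ.- (B zero j ℤ./ B zero l)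
  where instance _ = ℤ.≢-nonZero B₀ₗ≢0

euclidStep-decreases : ∀ {k n} (B : Matℤ (suc k) n) {j l} → j ≢ l → (B₀ₗ≢0 : B zero l ≢ + 0) →
  ℤ.∣ B zero l ∣ ℕ.≤ ℤ.∣ B zero j ∣ → firstRowSize (addColumn B j l (euclidMultiplier B j l B₀ₗ≢0)) ℕ.< firstRowSize B
euclidStep-decreases {n = n} B {j} {l} j≢l B₀ₗ≢0 ∣B₀ₗ∣≤∣B₀ⱼ∣ =
  ∑ℕ-mono-< n entry≤ j (ℕ.<-≤-trans ∣B′₀ⱼ∣<∣B₀ₗ∣ ∣B₀ₗ∣≤∣B₀ⱼ∣)
  where
  instance _ = ℤ.≢-nonZero B₀ₗ≢0
  a = B zero j
  b = B zero l
  σ = euclidMultiplier B j l B₀ₗ≢0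
  B′ = addColumn B j l σ
  B′₀ⱼ≡a%b : B′ zero j ≡ + (a ℤ.% b)
  B′₀ⱼ≡a%b = begin
    B′ zero j                                   ≡⟨ addColumn-≡ B j l σ zero ⟩
    a ℤ.+ ℤ.- (a ℤ./ b) ℤ.* b                   ≡⟨ cong (λ t → t ℤ.+ ℤ.- (a ℤ./ b) ℤ.* b) (ℤ.a≡a%n+[a/n]*n a b) ⟩
    + (a ℤ.% b) ℤ.+ (a ℤ./ b) ℤ.* b ℤ.+ ℤ.- (a ℤ./ b) ℤ.* b  ≡⟨ cancel (+ (a ℤ.% b)) (a ℤ./ b) b ⟩
    + (a ℤ.% b)                                 ∎
    where
    open ≡-Reasoning
    cancel : ∀ r q b → r ℤ.+ q ℤ.* b ℤ.+ ℤ.- q ℤ.* b ≡ r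
    cancel = solve-∀ℤ
  ∣B′₀ⱼ∣<∣B₀ₗ∣ : ℤ.∣ B′ zero j ∣ ℕ.< ℤ.∣ b ∣
  ∣B′₀ⱼ∣<∣B₀ₗ∣ rewrite B′₀ⱼ≡a%b = ℤ.n%d<d a b
  entry≤ : ∀ c → ℤ.∣ B′ zero c ∣ ℕ.≤ ℤ.∣ B zero c ∣
  entry≤ c with j ≟ c
  ... | yes refl = ℕ.<⇒≤ (ℕ.<-≤-trans ∣B′₀ⱼ∣<∣B₀ₗ∣ ∣B₀ₗ∣≤∣B₀ⱼ∣)
  ... | no  j≢c  = ℕ.≤-reflexive (cong ℤ.∣_∣ (addColumn-≢ B j l σ j≢c zero))

-- A p-adic version of Kronecker's theorem on integral solutions of linear systems

module _ (p : ℕ) .{{_ : ℕ.NonZero p}} where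

  KroneckerCondition : ∀ {k n} → Matℤ k n → Vecℚ k → Set
  KroneckerCondition B β = ∀ z → IsIntegralVec (B ᵀ*ᵥ z) → IsPadic p (β · z)

  PadicSolution : ∀ {k n} → Matℤ k n → Vecℚ k → Set
  PadicSolution {n = n} B β = Σ (Vecℚ n) λ y → IsPadicVec p y × (∀ i → (B *ᵥ y) i ≡ β i)

  kronecker-addColumn : ∀ {k n} (B : Matℤ k n) β j l σ → j ≢ l →
    KroneckerCondition B β → KroneckerCondition (addColumn B j l σ) β
  kronecker-addColumn B β j l σ j≢l kc z B′ᵀz-integral = kc z Bᵀz-integral
    where
    open ≡-Reasoning
    B′ = addColumn B j l σ
    column-l : (B′ ᵀ*ᵥ z) l ≡ (B ᵀ*ᵥ z) l
    column-l = begin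
      (B′ ᵀ*ᵥ z) l                                      ≡⟨ ᵀ*ᵥ-addColumn B j l σ z l ⟩
      (B ᵀ*ᵥ z) l + ιℤ σ * (B ᵀ*ᵥ z) l * ιℤ (δ j l)     ≡⟨ cong (λ d → (B ᵀ*ᵥ z) l + ιℤ σ * (B ᵀ*ᵥ z) l * ιℤ d) (δ-≢ j≢l) ⟩
      (B ᵀ*ᵥ z) l + ιℤ σ * (B ᵀ*ᵥ z) l * 0ℚ             ≡⟨ cong (_+_ ((B ᵀ*ᵥ z) l)) (ℚ.*-zeroʳ (ιℤ σ * (B ᵀ*ᵥ z) l)) ⟩
      (B ᵀ*ᵥ z) l + 0ℚ                                  ≡⟨ ℚ.+-identityʳ _ ⟩
      (B ᵀ*ᵥ z) l                                       ∎
    Bᵀz-integral : IsIntegralVec (B ᵀ*ᵥ z)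
    Bᵀz-integral c = subst IsIntegral Bᵀz≡ (integral-+ _ _ (B′ᵀz-integral c) (integral-neg _ correction-integral))
      where
      correction = ιℤ σ * (B ᵀ*ᵥ z) l * ιℤ (δ j c)
      correction-integral : IsIntegral correction
      correction-integral = integral-* _ _
        (integral-* _ _ (integral-ιℤ σ) (subst IsIntegral column-l (B′ᵀz-integral l))) (integral-ιℤ (δ j c))
      cancel : ∀ x y → x + y + - y ≡ x
      cancel = solve-∀ ℚ-ring
      Bᵀz≡ : (B′ ᵀ*ᵥ z) c + - correction ≡ (B ᵀ*ᵥ z) c
      Bᵀz≡ = trans (cong (_+ - correction) (ᵀ*ᵥ-addColumn B j l σ z c)) (cancel _ correction)

  solution-addColumn : ∀ {k n} (B : Matℤ k n) {β} j l σ →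
    PadicSolution (addColumn B j l σ) β → PadicSolution B β
  solution-addColumn B {β} j l σ (y′ , padic-y′ , solves′) = y , padic-y , solves
    where
    s = ιℤ σ * y′ j
    y : Vecℚ _
    y c = y′ c + s * ιℤ (δ l c)
    padic-y : IsPadicVec p y
    padic-y c = padic-+ p (y′ c) _ (padic-y′ c)
      (padic-* p s _ (padic-* p (ιℤ σ) (y′ j) (padic-ιℤ p σ) (padic-y′ j)) (padic-ιℤ p (δ l c)))
    reorder : ∀ s y b → s * y * b ≡ s * b * y
    reorder = solve-∀ ℚ-ring
    solves : ∀ i → (B *ᵥ y) i ≡ β i
    solves i = begin
      (B *ᵥ y) i                                   ≡⟨ ·-+δʳ (row B i) y′ s l ⟩
      (B *ᵥ y′) i + s * ιℤ (B i l)                 ≡⟨ cong (_+_ ((B *ᵥ y′) i)) (reorder (ιℤ σ) (y′ j) (ιℤ (B i l))) ⟩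
      (B *ᵥ y′) i + ιℤ σ * ιℤ (B i l) * y′ j       ≡⟨ *ᵥ-addColumn B j l σ y′ i ⟨
      (addColumn B j l σ *ᵥ y′) i                  ≡⟨ solves′ i ⟩
      β i                                          ∎
      where open ≡-Reasoning

  module _ {k n} (B : Matℤ (suc k) n) (β : Vecℚ (suc k)) (B₀≡0 : ∀ c → B zero c ≡ + 0) where

    ᵀ*ᵥ-zeroRow : ∀ t z c → (B ᵀ*ᵥ (t ∷ z)) c ≡ ((B ∘ suc) ᵀ*ᵥ z) c
    ᵀ*ᵥ-zeroRow t z c rewrite B₀≡0 c = trans (cong (_+ ((B ∘ suc) ᵀ*ᵥ z) c) (ℚ.*-zeroˡ t)) (ℚ.+-identityˡ _)

    zeroRow-kronecker : KroneckerCondition B β → β zero ≡ 0ℚ × KroneckerCondition (B ∘ suc) (β ∘ suc)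
    zeroRow-kronecker kc = padic-multiples⇒zero p (β zero) β₀t-padic , tail-kronecker
      where
      β₀t-padic : ∀ t → IsPadic p (β zero * t)
      β₀t-padic t = subst (IsPadic p) β·[t∷0]≡β₀t (kc (t ∷ 0ᵥ) Bᵀ[t∷0]-integral)
        where
        β·[t∷0]≡β₀t : β zero * t + (β ∘ suc) · 0ᵥ ≡ β zero * t
        β·[t∷0]≡β₀t = trans (cong (_+_ (β zero * t)) (·-zeroʳ (β ∘ suc))) (ℚ.+-identityʳ (β zero * t))
        Bᵀ[t∷0]-integral : IsIntegralVec (B ᵀ*ᵥ (t ∷ 0ᵥ))
        Bᵀ[t∷0]-integral c = subst IsIntegral (sym (trans (ᵀ*ᵥ-zeroRow t 0ᵥ c) (·-zeroʳ (λ i → ιℤ (B (suc i) c)))))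
          (integral-ιℤ (+ 0))
      tail-kronecker : KroneckerCondition (B ∘ suc) (β ∘ suc)
      tail-kronecker z int = subst (IsPadic p) β·[0∷z]≡β′·z
        (kc (0ℚ ∷ z) λ c → subst IsIntegral (sym (ᵀ*ᵥ-zeroRow 0ℚ z c)) (int c))
        where
        β·[0∷z]≡β′·z : β zero * 0ℚ + (β ∘ suc) · z ≡ (β ∘ suc) · z
        β·[0∷z]≡β′·z = trans (cong (_+ (β ∘ suc) · z) (ℚ.*-zeroʳ (β zero))) (ℚ.+-identityˡ ((β ∘ suc) · z))

    zeroRow-solution : β zero ≡ 0ℚ → PadicSolution (B ∘ suc) (β ∘ suc) → PadicSolution B β
    zeroRow-solution β₀≡0 (y , padic-y , solves) = y , padic-y , λ where
      zero    → trans (·-congˡ y (cong ιℤ ∘ B₀≡0)) (trans (·-comm 0ᵥ y) (trans (·-zeroʳ y) (sym β₀≡0)))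
      (suc i) → solves i

  module Pivot {k n} (B : Matℤ (suc k) n) (β : Vecℚ (suc k)) (l : Fin n) (g : ℤ) (g≢0 : g ≢ + 0)
               (B₀≡gδ : ∀ c → B zero c ≡ g ℤ.* δ l c) (kc : KroneckerCondition B β) where

    instance
      _ = ℚ.≢-nonZero (g≢0 ∘ ιℤ-injective)

    1/g : ℚ
    1/g = ℚ.1/ ιℤ g

    ᵀ*ᵥ-pivotRow : ∀ t z c → (B ᵀ*ᵥ (t ∷ z)) c ≡ ιℤ g * t * ιℤ (δ l c) + ((B ∘ suc) ᵀ*ᵥ z) c
    ᵀ*ᵥ-pivotRow t z c = cong (_+ ((B ∘ suc) ᵀ*ᵥ z) c)
      (trans (cong (λ b → ιℤ b * t) (B₀≡gδ c)) (trans (cong (_* t) (ιℤ-homo-* g (δ l c))) (reorder (ιℤ g) (ιℤ (δ l c)) t)))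
      where
      reorder : ∀ g d t → g * d * t ≡ g * t * d
      reorder = solve-∀ ℚ-ring

    yₗ : ℚ
    yₗ = β zero * 1/g

    padic-yₗ : IsPadic p yₗ
    padic-yₗ = subst (IsPadic p) (trans (cong (_+_ yₗ) (·-zeroʳ (β ∘ suc))) (ℚ.+-identityʳ yₗ))
      (kc (1/g ∷ 0ᵥ) λ c → subst IsIntegral (sym (column≡δ c)) (integral-ιℤ (δ l c)))
      where
      column≡δ : ∀ c → (B ᵀ*ᵥ (1/g ∷ 0ᵥ)) c ≡ ιℤ (δ l c)
      column≡δ c = begin
        (B ᵀ*ᵥ (1/g ∷ 0ᵥ)) c                                  ≡⟨ ᵀ*ᵥ-pivotRow 1/g 0ᵥ c ⟩
        ιℤ g * 1/g * ιℤ (δ l c) + ((B ∘ suc) ᵀ*ᵥ 0ᵥ) c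
          ≡⟨ cong₂ (λ s t → s * ιℤ (δ l c) + t) (ℚ.*-inverseʳ (ιℤ g)) (·-zeroʳ (λ i → ιℤ (B (suc i) c))) ⟩
        1ℚ * ιℤ (δ l c) + 0ℚ                                  ≡⟨ trans (ℚ.+-identityʳ _) (ℚ.*-identityˡ _) ⟩
        ιℤ (δ l c)                                            ∎
        where open ≡-Reasoning

    *ᵥ-pivotRow : ∀ y → (B *ᵥ y) zero ≡ ιℤ g * y l
    *ᵥ-pivotRow y = begin
      Σ[<] n (λ c → ιℤ (B zero c) * y c)          ≡⟨ Σ-cong n (λ c → cong (λ b → ιℤ b * y c) (B₀≡gδ c)) ⟩
      Σ[<] n (λ c → ιℤ (g ℤ.* δ l c) * y c)       ≡⟨ Σ-cong n (λ c → cong (_* y c) (ιℤ-homo-* g (δ l c))) ⟩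
      Σ[<] n (λ c → ιℤ g * ιℤ (δ l c) * y c)      ≡⟨ Σ-cong n (λ c → ℚ.*-assoc (ιℤ g) (ιℤ (δ l c)) (y c)) ⟩
      Σ[<] n (λ c → ιℤ g * (ιℤ (δ l c) * y c))    ≡⟨ *-distribˡ-Σ n (ιℤ g) _ ⟨
      ιℤ g * Σ[<] n (λ c → ιℤ (δ l c) * y c)      ≡⟨ cong (ιℤ g *_) (Σ-δ n y l) ⟩
      ιℤ g * y l                                  ∎
      where open ≡-Reasoning

    gyₗ≡β₀ : ιℤ g * yₗ ≡ β zero
    gyₗ≡β₀ = begin
      ιℤ g * (β zero * 1/g)     ≡⟨ reorder (ιℤ g) (β zero) 1/g ⟩
      β zero * (ιℤ g * 1/g)     ≡⟨ cong (β zero *_) (ℚ.*-inverseʳ (ιℤ g)) ⟩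
      β zero * 1ℚ               ≡⟨ ℚ.*-identityʳ (β zero) ⟩
      β zero                    ∎
      where
      open ≡-Reasoning
      reorder : ∀ g b i → g * (b * i) ≡ b * (g * i)
      reorder = solve-∀ ℚ-ring

    -- Column l of the remaining rows is cleared, and its contribution moved to the right-hand side.
    B′ : Matℤ k n
    B′ = addColumn (B ∘ suc) l l (ℤ.- + 1)

    β′ : Vecℚ k
    β′ i = β (suc i) + - yₗ * ιℤ (B (suc i) l)

    reduced-kronecker : KroneckerCondition B′ β′
    reduced-kronecker z B′ᵀz-integral = subst (IsPadic p) β·z≡β′·z
      (kc (t ∷ z) λ c → subst IsIntegral (sym (column≡ c)) (B′ᵀz-integral c))
      where
      open ≡-Reasoning
      S = ((B ∘ suc) ᵀ*ᵥ z) l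
      t = - S * 1/g
      gt≡-S : ιℤ g * t ≡ - S
      gt≡-S = begin
        ιℤ g * (- S * 1/g)      ≡⟨ reorder (ιℤ g) (- S) 1/g ⟩
        - S * (ιℤ g * 1/g)      ≡⟨ cong (- S *_) (ℚ.*-inverseʳ (ιℤ g)) ⟩
        - S * 1ℚ                ≡⟨ ℚ.*-identityʳ (- S) ⟩
        - S                     ∎
        where
        reorder : ∀ g s i → g * (s * i) ≡ s * (g * i)
        reorder = solve-∀ ℚ-ring
      column≡ : ∀ c → (B ᵀ*ᵥ (t ∷ z)) c ≡ (B′ ᵀ*ᵥ z) c
      column≡ c = begin
        (B ᵀ*ᵥ (t ∷ z)) c                                     ≡⟨ ᵀ*ᵥ-pivotRow t z c ⟩
        ιℤ g * t * ιℤ (δ l c) + ((B ∘ suc) ᵀ*ᵥ z) c           ≡⟨ cong (λ s → s * ιℤ (δ l c) + ((B ∘ suc) ᵀ*ᵥ z) c) gt≡-S ⟩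
        - S * ιℤ (δ l c) + ((B ∘ suc) ᵀ*ᵥ z) c                ≡⟨ reorder S (ιℤ (δ l c)) _ ⟩
        ((B ∘ suc) ᵀ*ᵥ z) c + - 1ℚ * S * ιℤ (δ l c)           ≡⟨ ᵀ*ᵥ-addColumn (B ∘ suc) l l (ℤ.- + 1) z c ⟨
        (B′ ᵀ*ᵥ z) c                                          ∎
        where
        reorder : ∀ s d x → - s * d + x ≡ x + - 1ℚ * s * d
        reorder = solve-∀ ℚ-ring
      β·z≡β′·z : β · (t ∷ z) ≡ β′ · z
      β·z≡β′·z = begin
        β zero * (- S * 1/g) + (β ∘ suc) · z      ≡⟨ reorder (β zero) S 1/g _ ⟩
        (β ∘ suc) · z + - yₗ * S                   ≡⟨ ·-linearˡ (β ∘ suc) (λ i → ιℤ (B (suc i) l)) z (- yₗ) ⟨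
        β′ · z                                    ∎
        where
        reorder : ∀ b s i x → b * (- s * i) + x ≡ x + - (b * i) * s
        reorder = solve-∀ ℚ-ring

    lift : PadicSolution B′ β′ → PadicSolution B β
    lift (y′ , padic-y′ , solves′) = y , padic-y , solves
      where
      open ≡-Reasoning
      s = yₗ + - y′ l
      y : Vecℚ n
      y c = y′ c + s * ιℤ (δ l c)
      padic-y : IsPadicVec p y
      padic-y c = padic-+ p (y′ c) _ (padic-y′ c) (padic-* p s _
        (padic-+ p yₗ _ padic-yₗ (padic-neg p (y′ l) (padic-y′ l))) (padic-ιℤ p (δ l c)))
      yₗ≡ : y l ≡ yₗ
      yₗ≡ = begin
        y′ l + s * ιℤ (δ l l)      ≡⟨ cong (λ d → y′ l + s * ιℤ d) (δ-refl l) ⟩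
        y′ l + s * 1ℚ              ≡⟨ cancel (y′ l) yₗ ⟩
        yₗ                         ∎
        where
        cancel : ∀ w y → w + (y + - w) * 1ℚ ≡ y
        cancel = solve-∀ ℚ-ring
      solves : ∀ i → (B *ᵥ y) i ≡ β i
      solves zero = trans (*ᵥ-pivotRow y) (trans (cong (ιℤ g *_) yₗ≡) gyₗ≡β₀)
      solves (suc i) = begin
        (B *ᵥ y) (suc i)                                 ≡⟨ ·-+δʳ (row B (suc i)) y′ s l ⟩
        R + s * a                                        ≡⟨ regroup R yₗ (y′ l) a ⟩
        (R + - 1ℚ * a * y′ l) + yₗ * a                   ≡⟨ cong (_+ yₗ * a) B′y′≡β′ ⟩
        (β (suc i) + - yₗ * a) + yₗ * a                  ≡⟨ cancel (β (suc i)) yₗ a ⟩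
        β (suc i)                                        ∎
        where
        R = ((B ∘ suc) *ᵥ y′) i
        a = ιℤ (B (suc i) l)
        B′y′≡β′ : R + - 1ℚ * a * y′ l ≡ β′ i
        B′y′≡β′ = trans (sym (*ᵥ-addColumn (B ∘ suc) l l (ℤ.- + 1) y′ i)) (solves′ i)
        regroup : ∀ r y w a → r + (y + - w) * a ≡ (r + - 1ℚ * a * w) + y * a
        regroup = solve-∀ ℚ-ring
        cancel : ∀ b y a → (b + - y * a) + y * a ≡ b
        cancel = solve-∀ ℚ-ring

  kronecker : ∀ k {n} (B : Matℤ k n) β → KroneckerCondition B β → PadicSolution B β
  kronecker zero    B β _  = 0ᵥ , (λ _ → padic-ιℤ p (+ 0)) , λ ()
  kronecker (suc k) B β kc = eliminateFirstRow B β (<-wellFounded (firstRowSize B)) kc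
    where
    eliminateFirstRow : ∀ {n} (B : Matℤ (suc k) n) β → Acc ℕ._<_ (firstRowSize B) →
                        KroneckerCondition B β → PadicSolution B β
    eliminateFirstRow B β (acc smaller) kc with rowShape (B zero)
    ... | zeroRow B₀≡0 =
      let β₀≡0 , tail-kc = zeroRow-kronecker B β B₀≡0 kc
      in zeroRow-solution B β B₀≡0 β₀≡0 (kronecker k (B ∘ suc) (β ∘ suc) tail-kc)
    ... | multipleOfUnit l g g≢0 B₀≡gδ =
      let open Pivot B β l g g≢0 B₀≡gδ kc
      in lift (kronecker k B′ β′ reduced-kronecker)
    ... | twoNonzero j l j≢l B₀ⱼ≢0 B₀ₗ≢0 with ℕ.≤-total ℤ.∣ B zero l ∣ ℤ.∣ B zero j ∣
    ...   | inj₁ ∣B₀ₗ∣≤∣B₀ⱼ∣ = let σ = euclidMultiplier B j l B₀ₗ≢0 in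
      solution-addColumn B j l σ (eliminateFirstRow (addColumn B j l σ) β
        (smaller (euclidStep-decreases B j≢l B₀ₗ≢0 ∣B₀ₗ∣≤∣B₀ⱼ∣)) (kronecker-addColumn B β j l σ j≢l kc))
    ...   | inj₂ ∣B₀ⱼ∣≤∣B₀ₗ∣ = let σ = euclidMultiplier B l j B₀ⱼ≢0 in
      solution-addColumn B l j σ (eliminateFirstRow (addColumn B l j σ) β
        (smaller (euclidStep-decreases B (j≢l ∘ sym) B₀ⱼ≢0 ∣B₀ⱼ∣≤∣B₀ₗ∣)) (kronecker-addColumn B β l j σ (j≢l ∘ sym) kc))

equation-on-affineHull : ∀ {n} {S : Vecℚ n → Set} (a : Vecℚ n) β → (∀ x → S x → a · x ≡ β) →
                         ∀ y → InAffHull S y → a · y ≡ β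
equation-on-affineHull {n} a β on-S y (k , λs , xs , xs∈S , Σλ≡1 , y≡) = begin
  a · y                                                  ≡⟨ ·-congʳ a y≡ ⟩
  Σ[<] n (λ j → a j * Σ[<] k (λ t → λs t * xs t j))      ≡⟨ Σ-cong n (λ j → *-distribˡ-Σ k (a j) _) ⟩
  Σ[<] n (λ j → Σ[<] k (λ t → a j * (λs t * xs t j)))    ≡⟨ Σ-comm n k _ ⟩
  Σ[<] k (λ t → Σ[<] n (λ j → a j * (λs t * xs t j)))    ≡⟨ Σ-cong k (λ t → Σ-cong n (λ j → reorder (a j) (λs t) (xs t j))) ⟩
  Σ[<] k (λ t → Σ[<] n (λ j → λs t * (a j * xs t j)))    ≡⟨ Σ-cong k (λ t → *-distribˡ-Σ n (λs t) _) ⟨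
  Σ[<] k (λ t → λs t * (a · xs t))                       ≡⟨ Σ-cong k (λ t → cong (λs t *_) (on-S (xs t) (xs∈S t))) ⟩
  Σ[<] k (λ t → λs t * β)                                ≡⟨ *-distribʳ-Σ k β λs ⟨
  Σ[<] k λs * β                                          ≡⟨ cong (_* β) Σλ≡1 ⟩
  1ℚ * β                                                 ≡⟨ ℚ.*-identityˡ β ⟩
  β                                                      ∎
  where
  open ≡-Reasoning
  reorder : ∀ a l x → a * (l * x) ≡ l * (a * x)
  reorder = solve-∀ ℚ-ring

module _ {m n} (A : Matℤ m n) (b : Fin m → ℤ) where

  optimal⇒nonemptyFace : ∀ w {x} → IsOptimal A b w x → IsNonemptyFace A b w (w · x)
  optimal⇒nonemptyFace w {x} (x∈P , x-max) = x-max , x , x∈P , refl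

  inFace⇒optimal : ∀ c {δ x} → Valid A b c δ → InFace A b c δ x → IsOptimal A b c x
  inFace⇒optimal c valid (x∈P , cx≡δ) = x∈P , λ y y∈P → subst (c · y ≤_) (sym cx≡δ) (valid y y∈P)

  optimal-cong : ∀ {w w′ x} → (∀ j → w j ≡ w′ j) → IsOptimal A b w x → IsOptimal A b w′ x
  optimal-cong {x = x} w≗w′ (x∈P , x-max) = x∈P , λ y y∈P →
    subst₂ _≤_ (·-congˡ y w≗w′) (·-congˡ x w≗w′) (x-max y y∈P)

  certificate-optimal : ∀ {x} (v : Vecℚ m) → (∀ i → 0ℚ ≤ v i) → InP A b x →
    (∀ i → v i ≢ 0ℚ → (A *ᵥ x) i ≡ ιℤ (b i)) → IsOptimal A b (A ᵀ*ᵥ v) x × (A ᵀ*ᵥ v) · x ≡ ιᵥ b · v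
  certificate-optimal {x} v v≥0 x∈P slackness = (x∈P , bounded) , value
    where
    value : (A ᵀ*ᵥ v) · x ≡ ιᵥ b · v
    value = trans (sym (*ᵥ-ᵀ*ᵥ-adjoint A x v)) (·-cong-on-support (A *ᵥ x) (ιᵥ b) v slackness)
    bounded : ∀ y → InP A b y → (A ᵀ*ᵥ v) · y ≤ (A ᵀ*ᵥ v) · x
    bounded y y∈P = begin
      (A ᵀ*ᵥ v) · y       ≡⟨ *ᵥ-ᵀ*ᵥ-adjoint A y v ⟨
      (A *ᵥ y) · v        ≤⟨ Σ-mono-≤ m (λ i → ℚ.*-monoʳ-≤-nonNeg (v i) {{ℚ.nonNegative (v≥0 i)}} (y∈P i)) ⟩
      ιᵥ b · v            ≡⟨ value ⟨
      (A ᵀ*ᵥ v) · x       ∎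
      where open ℚ.≤-Reasoning

  segment-feasible : ∀ {x} → InP A b x → ∀ d → (∀ i → (A *ᵥ x) i ≡ ιℤ (b i) → (A *ᵥ d) i ≡ 0ℚ) →
    ∃ λ N → ∀ σ → ιℕ N * ℚ.∣ σ ∣ ≤ 1ℚ → InP A b (λ j → x j + σ * d j)
  segment-feasible {x} x∈P d tight⇒Ad≡0 = N , feasible
    where
    slack : Fin m → ℚ
    slack i = ιℤ (b i) + - (A *ᵥ x) i
    slack≥0 : ∀ i → 0ℚ ≤ slack i
    slack≥0 i = subst (_≤ slack i) (ℚ.+-inverseʳ ((A *ᵥ x) i)) (ℚ.+-monoˡ-≤ (- (A *ᵥ x) i) (x∈P i))
    tight : ∀ i → slack i ≡ 0ℚ → (A *ᵥ x) i ≡ ιℤ (b i)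
    tight i slackᵢ≡0 = begin
      (A *ᵥ x) i                 ≡⟨ ℚ.+-identityˡ _ ⟨
      0ℚ + (A *ᵥ x) i            ≡⟨ cong (_+ (A *ᵥ x) i) slackᵢ≡0 ⟨
      slack i + (A *ᵥ x) i       ≡⟨ restore (ιℤ (b i)) ((A *ᵥ x) i) ⟩
      ιℤ (b i)                   ∎
      where
      open ≡-Reasoning
      restore : ∀ b a → b + - a + a ≡ b
      restore = solve-∀ ℚ-ring
    N,bound = common-bound m (λ i N → ℚ.∣ (A *ᵥ d) i ∣ ≤ ιℕ N * slack i)
      (λ i M≤N bound → ℚ.≤-trans bound (ℚ.*-monoʳ-≤-nonNeg (slack i) {{ℚ.nonNegative (slack≥0 i)}} (ιℕ-mono-≤ M≤N)))
      (λ i → scaled-bound _ (slack i) (slack≥0 i) (tight⇒Ad≡0 i ∘ tight i))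
    N = proj₁ N,bound
    feasible : ∀ σ → ιℕ N * ℚ.∣ σ ∣ ≤ 1ℚ → InP A b (λ j → x j + σ * d j)
    feasible σ N∣σ∣≤1 i = begin
      row A i · (λ j → x j + σ * d j)        ≡⟨ ·-linearʳ (row A i) x d σ ⟩
      (A *ᵥ x) i + σ * (A *ᵥ d) i            ≤⟨ ℚ.+-monoʳ-≤ ((A *ᵥ x) i) σα≤slack ⟩
      (A *ᵥ x) i + slack i                   ≡⟨ restore ((A *ᵥ x) i) (ιℤ (b i)) ⟩
      ιℤ (b i)                               ∎
      where
      open ℚ.≤-Reasoning
      restore : ∀ a b → a + (b + - a) ≡ b
      restore = solve-∀ ℚ-ring
      σα≤slack : σ * (A *ᵥ d) i ≤ slack i
      σα≤slack = scaled-step σ ((A *ᵥ d) i) (slack i) N (slack≥0 i) (proj₂ N,bound i) N∣σ∣≤1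

  segment-in-face : ∀ {c δ x} d σ → Valid A b c δ → c · x ≡ δ →
    InP A b (λ j → x j + σ * d j) → InP A b (λ j → x j + - σ * d j) → c · (λ j → x j + σ * d j) ≡ δ
  segment-in-face {c} {δ} {x} d σ valid cx≡δ forward∈P backward∈P = begin
    c · (λ j → x j + σ * d j)     ≡⟨ ·-linearʳ c x d σ ⟩
    c · x + t                     ≡⟨ cong₂ _+_ cx≡δ t≡0 ⟩
    δ + 0ℚ                        ≡⟨ ℚ.+-identityʳ δ ⟩
    δ                             ∎
    where
    open ≡-Reasoning
    t = σ * (c · d)
    drop : ∀ {s} → c · x + s ≤ c · x → s ≤ 0ℚ
    drop {s} le = subst₂ _≤_ (cancel (c · x) s) (ℚ.+-inverseˡ (c · x)) (ℚ.+-monoʳ-≤ (- (c · x)) le)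
      where
      cancel : ∀ a s → - a + (a + s) ≡ s
      cancel = solve-∀ ℚ-ring
    t≤0 : t ≤ 0ℚ
    t≤0 = drop (subst (_≤ c · x) (·-linearʳ c x d σ) (subst (_ ≤_) (sym cx≡δ) (valid _ forward∈P)))
    -t≤0 : - t ≤ 0ℚ
    -t≤0 = drop (subst (_≤ c · x) (trans (·-linearʳ c x d (- σ)) (cong (_+_ (c · x)) (sym (ℚ.neg-distribˡ-* σ (c · d)))))
                  (subst (_ ≤_) (sym cx≡δ) (valid _ backward∈P)))
    t≡0 : t ≡ 0ℚ
    t≡0 = ℚ.≤-antisym t≤0 (subst (0ℚ ≤_) (involutive t) (ℚ.neg-antimono-≤ -t≤0))
      where
      involutive : ∀ t → - - t ≡ t
      involutive = solve-∀ ℚ-ring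

  -- The smallest face containing x: the rows of A x ≤ b that are tight at x are kept, the others
  -- are replaced by 0 ≤ 0, and the face is cut out by the sum of the kept rows.
  module SmallestFace {x : Vecℚ n} (x∈P : InP A b x) where

    TightAt : Fin m → Set
    TightAt i = (A *ᵥ x) i ≡ ιℤ (b i)

    tightAt? : ∀ i → Dec (TightAt i)
    tightAt? i = (A *ᵥ x) i ℚ.≟ ιℤ (b i)

    Aₓ : Matℤ m n
    Aₓ i j with tightAt? i
    ... | yes _ = A i j
    ... | no  _ = + 0

    bₓ : Fin m → ℤ
    bₓ i with tightAt? i
    ... | yes _ = b i
    ... | no  _ = + 0

    1ᵥ : Vecℚ m
    1ᵥ _ = 1ℚ

    cₓ : Vecℚ n
    cₓ = Aₓ ᵀ*ᵥ 1ᵥ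

    δₓ : ℚ
    δₓ = ιᵥ bₓ · 1ᵥ

    kept-row : ∀ {i} → TightAt i → ∀ y → (Aₓ *ᵥ y) i ≡ (A *ᵥ y) i × bₓ i ≡ b i
    kept-row {i} tᵢ y with tightAt? i
    ... | yes _   = refl , refl
    ... | no  ¬tᵢ = ⊥-elim (¬tᵢ tᵢ)

    restricted-≤ : ∀ {y} → InP A b y → ∀ i → (Aₓ *ᵥ y) i ≤ ιℤ (bₓ i)
    restricted-≤ {y} y∈P i with tightAt? i
    ... | yes _ = y∈P i
    ... | no  _ = ℚ.≤-reflexive (trans (·-comm _ y) (·-zeroʳ y))

    restricted-at-x : ∀ i → (Aₓ *ᵥ x) i ≡ ιℤ (bₓ i)
    restricted-at-x i with tightAt? i
    ... | yes tᵢ = tᵢ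
    ... | no  _  = trans (·-comm _ x) (·-zeroʳ x)

    cₓ-value : ∀ y → cₓ · y ≡ (Aₓ *ᵥ y) · 1ᵥ
    cₓ-value y = sym (*ᵥ-ᵀ*ᵥ-adjoint Aₓ y 1ᵥ)

    face : IsNonemptyFace A b cₓ δₓ
    face = valid , x , x∈P , trans (cₓ-value x) (Σ-cong m (λ i → cong (_* 1ℚ) (restricted-at-x i)))
      where
      valid : Valid A b cₓ δₓ
      valid y y∈P = ℚ.≤-trans (ℚ.≤-reflexive (cₓ-value y))
        (Σ-mono-≤ m (λ i → ℚ.*-monoʳ-≤-nonNeg 1ℚ (restricted-≤ y∈P i)))

    tight-on-face : ∀ i → TightAt i → Tight A b cₓ δₓ i
    tight-on-face i tᵢ y (y∈P , cₓy≡δₓ) = begin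
      (A *ᵥ y) i            ≡⟨ proj₁ (kept-row tᵢ y) ⟨
      (Aₓ *ᵥ y) i           ≡⟨ ℚ.*-identityʳ _ ⟨
      (Aₓ *ᵥ y) i * 1ℚ      ≡⟨ termwise i ⟩
      ιℤ (bₓ i) * 1ℚ        ≡⟨ ℚ.*-identityʳ _ ⟩
      ιℤ (bₓ i)             ≡⟨ cong ιℤ (proj₂ (kept-row tᵢ y)) ⟩
      ιℤ (b i)              ∎
      where
      open ≡-Reasoning
      termwise : ∀ i → (Aₓ *ᵥ y) i * 1ℚ ≡ ιℤ (bₓ i) * 1ℚ
      termwise = Σ-≤-≡⇒≡ m (λ i → ℚ.*-monoʳ-≤-nonNeg 1ℚ (restricted-≤ y∈P i)) (trans (sym (cₓ-value y)) cₓy≡δₓ)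

    restricted-kronecker : ∀ p → .{{_ : ℕ.NonZero p}} → Cond3 p A b → KroneckerCondition p Aₓ (ιᵥ bₓ)
    restricted-kronecker p cond3 z Aₓᵀz-integral =
      subst (IsPadic p) (Σ-cong m (sym ∘ b-term)) (cond3 cₓ δₓ face z′ z′-support Aᵀz′-integral)
      where
      z′ : Vecℚ m
      z′ i with tightAt? i
      ... | yes _ = z i
      ... | no  _ = 0ℚ
      b-term : ∀ i → ιℤ (bₓ i) * z i ≡ ιℤ (b i) * z′ i
      b-term i with tightAt? i
      ... | yes _ = refl
      ... | no  _ = trans (ℚ.*-zeroˡ (z i)) (sym (ℚ.*-zeroʳ (ιℤ (b i))))
      z′-support : ∀ i → z′ i ≢ 0ℚ → Tight A b cₓ δₓ i
      z′-support i z′ᵢ≢0 with tightAt? i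
      ... | yes tᵢ = tight-on-face i tᵢ
      ... | no  _  = ⊥-elim (z′ᵢ≢0 refl)
      A-term : ∀ j i → ιℤ (Aₓ i j) * z i ≡ ιℤ (A i j) * z′ i
      A-term j i with tightAt? i
      ... | yes _ = refl
      ... | no  _ = trans (ℚ.*-zeroˡ (z i)) (sym (ℚ.*-zeroʳ (ιℤ (A i j))))
      Aᵀz′-integral : IsIntegralVec (A ᵀ*ᵥ z′)
      Aᵀz′-integral j = subst IsIntegral (Σ-cong m (A-term j)) (Aₓᵀz-integral j)

    tight-padic-solution : ∀ p → .{{_ : ℕ.NonZero p}} → Cond3 p A b →
      Σ (Vecℚ n) λ y₀ → IsPadicVec p y₀ × (∀ i → TightAt i → (A *ᵥ y₀) i ≡ ιℤ (b i))
    tight-padic-solution p cond3 = y₀ , padic-y₀ , y₀-tight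
      where
      solution = kronecker p m Aₓ (ιᵥ bₓ) (restricted-kronecker p cond3)
      y₀ = proj₁ solution
      padic-y₀ = proj₁ (proj₂ solution)
      y₀-tight : ∀ i → TightAt i → (A *ᵥ y₀) i ≡ ιℤ (b i)
      y₀-tight i tᵢ = begin
        (A *ᵥ y₀) i      ≡⟨ proj₁ (kept-row tᵢ y₀) ⟨
        (Aₓ *ᵥ y₀) i     ≡⟨ proj₂ (proj₂ solution) i ⟩
        ιℤ (bₓ i)        ≡⟨ cong ιℤ (proj₂ (kept-row tᵢ y₀)) ⟩
        ιℤ (b i)         ∎
        where open ≡-Reasoning

  module _ (p : ℕ) where

    cond1⇒cond2 : Cond1 p A b → Cond2 p A b
    cond1⇒cond2 cond1 c δ face =
      let x , x∈F , padic-x = cond1 c δ face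
      in x , (1 , (λ _ → 1ℚ) , (λ _ → x) , (λ _ → x∈F) , ℚ.+-identityʳ 1ℚ ,
              λ j → sym (trans (ℚ.+-identityʳ _) (ℚ.*-identityˡ (x j)))) , padic-x

    cond2⇒cond3 : Cond2 p A b → Cond3 p A b
    cond2⇒cond3 cond2 c δ face z z-tight Aᵀz-integral = subst (IsPadic p) b·z≡ padic-Aᵀz·y
      where
      y,y∈aff = cond2 c δ face
      y = proj₁ y,y∈aff
      Ay≡b : ∀ i → z i ≢ 0ℚ → (A *ᵥ y) i ≡ ιℤ (b i)
      Ay≡b i zᵢ≢0 = equation-on-affineHull (row A i) (ιℤ (b i)) (z-tight i zᵢ≢0) y (proj₁ (proj₂ y,y∈aff))
      b·z≡ : (A ᵀ*ᵥ z) · y ≡ ιᵥ b · z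
      b·z≡ = trans (sym (*ᵥ-ᵀ*ᵥ-adjoint A y z)) (·-cong-on-support (A *ᵥ y) (ιᵥ b) z Ay≡b)
      padic-Aᵀz·y : IsPadic p ((A ᵀ*ᵥ z) · y)
      padic-Aᵀz·y = padic-· p (A ᵀ*ᵥ z) y (λ j → integral⇒padic p _ (Aᵀz-integral j)) (proj₂ (proj₂ y,y∈aff))

    cond1⇒cond4 : Cond1 p A b → Cond4 p A b
    cond1⇒cond4 cond1 w (x , x-optimal) =
      let y , (y∈P , wy≡wx) , padic-y = cond1 w (w · x) (optimal⇒nonemptyFace w x-optimal)
      in y , inFace⇒optimal w (proj₁ (optimal⇒nonemptyFace w x-optimal)) (y∈P , wy≡wx) , padic-y

    cond4⇒cond1 : Cond4 p A b → Cond1 p A b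
    cond4⇒cond1 cond4 c δ (valid , x , x∈F) =
      let y , (y∈P , y-max) , padic-y = cond4 c (x , inFace⇒optimal c valid x∈F)
      in y , (y∈P , ℚ.≤-antisym (valid y y∈P) (subst (_≤ c · y) (proj₂ x∈F) (y-max x (proj₁ x∈F)))) , padic-y

    cond1⇒cond5 : Cond1 p A b → Cond5 p A b
    cond1⇒cond5 cond1 w _ x x-optimal =
      let y , (_ , wy≡wx) , padic-y = cond1 (ιᵥ w) (ιᵥ w · x) (optimal⇒nonemptyFace (ιᵥ w) x-optimal)
      in subst (IsPadic p) wy≡wx (padic-· p (ιᵥ w) y (padic-ιℤ p ∘ w) padic-y)

  module _ (p : ℕ) (cond5 : Cond5 p A b) where

    cond5-certificate-padic : ∀ {x} (v : Vecℚ m) → (∀ i → 0ℚ ≤ v i) → InP A b x →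
      (∀ i → v i ≢ 0ℚ → (A *ᵥ x) i ≡ ιℤ (b i)) → IsIntegralVec (A ᵀ*ᵥ v) → IsPadic p (ιᵥ b · v)
    cond5-certificate-padic {x} v v≥0 x∈P slackness Aᵀv-integral =
      subst (IsPadic p) (trans (·-congˡ x w≡Aᵀv) value) (cond5 w (x , x-optimal) x x-optimal)
      where
      w : Fin n → ℤ
      w j = proj₁ (Aᵀv-integral j)
      w≡Aᵀv : ∀ j → ιℤ (w j) ≡ (A ᵀ*ᵥ v) j
      w≡Aᵀv j = sym (proj₂ (Aᵀv-integral j))
      certificate = certificate-optimal v v≥0 x∈P slackness
      value = proj₂ certificate
      x-optimal : IsOptimal A b (ιᵥ w) x
      x-optimal = optimal-cong (sym ∘ w≡Aᵀv) (proj₁ certificate)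

    cond5⇒cond3 : Cond3 p A b
    cond5⇒cond3 c δ (_ , x , x∈F) z z-tight Aᵀz-integral =
      padic-difference p (ιᵥ b · ιᵥ u) (ιᵥ b · z)
        (subst (IsPadic p) (·-distribˡ-+ (ιᵥ b) (ιᵥ u) z) padic-b·v) padic-b·u
      where
      shift = nonnegative-shift z
      u = proj₁ shift
      u-support = proj₂ (proj₂ (proj₂ shift))
      v : Vecℚ m
      v i = ιℤ (u i) + z i
      x∈P = proj₁ x∈F
      slack-u : ∀ i → ιℤ (u i) ≢ 0ℚ → (A *ᵥ x) i ≡ ιℤ (b i)
      slack-u i uᵢ≢0 = z-tight i (λ zᵢ≡0 → uᵢ≢0 (cong ιℤ (u-support i zᵢ≡0))) x x∈F
      slack-v : ∀ i → v i ≢ 0ℚ → (A *ᵥ x) i ≡ ιℤ (b i)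
      slack-v i vᵢ≢0 = z-tight i (λ zᵢ≡0 → vᵢ≢0 (cong₂ _+_ (cong ιℤ (u-support i zᵢ≡0)) zᵢ≡0)) x x∈F
      Aᵀu-integral : IsIntegralVec (A ᵀ*ᵥ ιᵥ u)
      Aᵀu-integral j = integral-Σ m _ (λ i → integral-* _ _ (integral-ιℤ (A i j)) (integral-ιℤ (u i)))
      Aᵀv-integral : IsIntegralVec (A ᵀ*ᵥ v)
      Aᵀv-integral j = subst IsIntegral (sym (·-distribˡ-+ (λ i → ιℤ (A i j)) (ιᵥ u) z))
        (integral-+ _ _ (Aᵀu-integral j) (Aᵀz-integral j))
      padic-b·u = cond5-certificate-padic (ιᵥ u) (proj₁ (proj₂ shift)) x∈P slack-u Aᵀu-integral
      padic-b·v = cond5-certificate-padic v (proj₁ (proj₂ (proj₂ shift))) x∈P slack-v Aᵀv-integral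

  towards-padic-point : ∀ p → 1 ℕ.< p → ∀ {c δ x} → Valid A b c δ → InFace A b c δ x →
    ∀ y₀ → IsPadicVec p y₀ → (∀ i → (A *ᵥ x) i ≡ ιℤ (b i) → (A *ᵥ y₀) i ≡ ιℤ (b i)) →
    Σ (Vecℚ n) λ y → InFace A b c δ y × IsPadicVec p y
  towards-padic-point p 1<p {c} {δ} {x} valid (x∈P , cx≡δ) y₀ padic-y₀ y₀-tight =
    y , (forward∈P , segment-in-face {c} {δ} {x} d τ valid cx≡δ forward∈P backward∈P) , padic-y
    where
    d : Vecℚ n
    d j = y₀ j + - 1ℚ * x j
    Ad≡0 : ∀ i → (A *ᵥ x) i ≡ ιℤ (b i) → (A *ᵥ d) i ≡ 0ℚ
    Ad≡0 i tᵢ = begin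
      (A *ᵥ d) i                          ≡⟨ ·-linearʳ (row A i) y₀ x (- 1ℚ) ⟩
      (A *ᵥ y₀) i + - 1ℚ * (A *ᵥ x) i     ≡⟨ cong₂ (λ s t → s + - 1ℚ * t) (y₀-tight i tᵢ) tᵢ ⟩
      ιℤ (b i) + - 1ℚ * ιℤ (b i)          ≡⟨ cancel (ιℤ (b i)) ⟩
      0ℚ                                  ∎
      where
      open ≡-Reasoning
      cancel : ∀ b → b + - 1ℚ * b ≡ 0ℚ
      cancel = solve-∀ ℚ-ring
    N,feasible = segment-feasible x∈P d Ad≡0
    N = proj₁ N,feasible
    shrink = padic-shrink p 1<p x N
    τ = proj₁ shrink
    ∣τ∣≡τ : ℚ.∣ τ ∣ ≡ τ
    ∣τ∣≡τ = ℚ.0≤p⇒∣p∣≡p (proj₁ (proj₂ shrink))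
    N∣±τ∣≤1 : ∀ {t} → ℚ.∣ t ∣ ≡ τ → ιℕ N * ℚ.∣ t ∣ ≤ 1ℚ
    N∣±τ∣≤1 ∣t∣≡τ = subst (λ t → ιℕ N * t ≤ 1ℚ) (sym ∣t∣≡τ) (proj₁ (proj₂ (proj₂ shrink)))
    forward∈P : InP A b (λ j → x j + τ * d j)
    forward∈P = proj₂ N,feasible τ (N∣±τ∣≤1 ∣τ∣≡τ)
    backward∈P : InP A b (λ j → x j + - τ * d j)
    backward∈P = proj₂ N,feasible (- τ) (N∣±τ∣≤1 (trans (ℚ.∣-p∣≡∣p∣ τ) ∣τ∣≡τ))
    y : Vecℚ n
    y j = x j + τ * d j
    padic-y : IsPadicVec p y
    padic-y j = subst (IsPadic p) (regroup (x j) τ (y₀ j))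
      (padic-+ p ((1ℚ + - τ) * x j) (τ * y₀ j) (proj₂ (proj₂ (proj₂ (proj₂ shrink))) j)
        (padic-* p τ (y₀ j) (proj₁ (proj₂ (proj₂ (proj₂ shrink)))) (padic-y₀ j)))
      where
      regroup : ∀ x t y → (1ℚ + - t) * x + t * y ≡ x + t * (y + - 1ℚ * x)
      regroup = solve-∀ ℚ-ring

  cond3⇒cond1 : ∀ p → 1 ℕ.< p → Cond3 p A b → Cond1 p A b
  cond3⇒cond1 p 1<p cond3 c δ (valid , x , x∈F) =
    let open SmallestFace (proj₁ x∈F)
        y₀ , padic-y₀ , y₀-tight = tight-padic-solution p {{ℕ.>-nonZero (ℕ.<⇒≤ 1<p)}} cond3
    in towards-padic-point p 1<p {c} {δ} {x} valid x∈F y₀ padic-y₀ y₀-tight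


theorem5p2 : (p m n : ℕ) → Prime p → (A : Matℤ m n) → (b : Fin m → ℤ) → NonemptyP A b →
    (Cond1 p A b ⇔ Cond2 p A b) × (Cond1 p A b ⇔ Cond3 p A b) × (Cond1 p A b ⇔ Cond4 p A b) × (Cond1 p A b ⇔ Cond5 p A b)
theorem5p2 p m n p-prime A b _ =
  mk⇔ (cond1⇒cond2 A b p) (cond3⇒cond1 A b p 1<p ∘ cond2⇒cond3 A b p) ,
  mk⇔ (cond2⇒cond3 A b p ∘ cond1⇒cond2 A b p) (cond3⇒cond1 A b p 1<p) ,
  mk⇔ (cond1⇒cond4 A b p) (cond4⇒cond1 A b p) ,
  mk⇔ (cond1⇒cond5 A b p) (cond3⇒cond1 A b p 1<p ∘ cond5⇒cond3 A b p)
  where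
  1<p : 1 ℕ.< p
  1<p = ℕ.nonTrivial⇒n>1 p {{prime⇒nonTrivial p-prime}}
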